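{- Let $\{a,b,c\}=\{1,2,3\}$. For $n\ge 1$, $a_n(a;b\to c)=2^{n-1}$.
   Context: Standard cycle form of $\sigma\in S_n$: $\sigma$ is written as a product of disjoint cycles (fixed points included), each cycle starting with its largest element, cycles listed in increasing order of their largest elements. The fundamental bijection $\theta:S_n\to S_n$ sends $\sigma$ to the permutation whose one-line notation is obtained by erasing the parentheses from the standard cycle form of $\sigma$. For $\pi\in S_n$ write $\hat\pi=\theta^{ -1}(\pi)$. An arrow pattern $\alpha=(\nu;H)$ of size $k$ consists of a string $\nu=a_1\dots a_m$ of positive integers and a set $H=\{b_i\to c_i\}$ of arrows such that the integers appearing in $\nu$ or $H$ form exactly $[k]$. $\pi\in S_n$ contains $\alpha$ if there is $X=\{x_1<\dots<x_k\}\subseteq[n]$ such that there are positions $t_1<\dots<t_m$ with $\pi_{t_1}\cdots\pi_{t_m}=x_{a_1}\cdots x_{a_m}$, and $\hat\pi(x_{b_i})=x_{c_i}$ for every arrow $b_i\to c_i\in H$; otherwise $\pi$ avoids $\alpha$. $a_n(\nu;H)$ is the number of $\pi\in S_n$ avoiding $(\nu;H)$. Here $(a;b\to c)$ is the size-3 arrow pattern with one-letter string $\nu=a$ and single arrow $b\to c$. -}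

module Defs where

open import Data.Nat using (ℕ; zero; suc; _≤_; _<_; _∸_; _^_)
open import Data.Fin as F using (Fin)
open import Data.Vec using (Vec; lookup; toList)
open import Data.List using (List; []; _∷_; concatMap; map; upTo; length)
open import Data.List.Relation.Unary.All using (All)
open import Data.List.Relation.Unary.Linked using (Linked)
open import Data.List.Relation.Unary.Unique.Propositional using (Unique)
open import Data.List.Membership.Propositional using (_∈_)
open import Data.Product using (Σ; _×_; ∃; ∃-syntax)
open import Relation.Binary.PropositionalEquality using (_≡_)
open import Relation.Nullary using (¬_)

-- A permutation of [n] = {0,…,n-1} (0-based), represented by its
-- one-line notation  σ(0) σ(1) … σ(n-1)  as a vector; σ(i) = lookup σ i.
Perm : ℕ → Set
Perm n = Vec (Fin n) n

IsPerm : ∀ {n} → Perm n → Set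
IsPerm {n} σ = ∀ (i j : Fin n) → lookup σ i ≡ lookup σ j → i ≡ j

iter : ∀ {n} → Perm n → ℕ → Fin n → Fin n
iter σ zero    x = x
iter σ (suc k) x = lookup σ (iter σ k x)

-- A cycle given by (leader m, length ℓ) written out: m σ(m) … σ^{ℓ-1}(m)
cycleList : ∀ {n} → Perm n → Fin n × ℕ → List (Fin n)
cycleList σ (m Data.Product., ℓ) = map (λ k → iter σ k m) (upTo ℓ)

ValidCycle : ∀ {n} → Perm n → Fin n × ℕ → Set
ValidCycle σ (m Data.Product., ℓ) =
  (1 ≤ ℓ) × (iter σ ℓ m ≡ m) × (∀ k → k < ℓ → iter σ k m F.≤ m)

leader : ∀ {n} → Fin n × ℕ → Fin n
leader = Data.Product.proj₁

-- C is the standard cycle form of σ: a list of cycles, each starting with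
-- its largest element, listed by increasing largest elements, disjoint and
-- covering all of [n] (fixed points included as cycles of length 1).
StdCycleForm : ∀ {n} → Perm n → List (Fin n × ℕ) → Set
StdCycleForm {n} σ C =
  All (ValidCycle σ) C ×
  Linked (λ p q → leader p F.< leader q) C ×
  Unique (concatMap (cycleList σ) C) ×
  (∀ (x : Fin n) → x ∈ concatMap (cycleList σ) C)

-- θ(σ) = π : erasing the parentheses of the standard cycle form of σ
-- gives the one-line notation of π.
Theta : ∀ {n} → Perm n → Perm n → Set
Theta σ π = ∃[ C ] (StdCycleForm σ C × (concatMap (cycleList σ) C ≡ toList π))

-- π̂(x) = y, where π̂ = θ⁻¹(π)
HatMaps : ∀ {n} → Perm n → Fin n → Fin n → Set
HatMaps π x y = ∃[ σ ] (IsPerm σ × Theta σ π × lookup σ x ≡ y)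

-- Arrow pattern of size k (letters 0-based: letter i ∈ Fin k stands for i+1):
-- a string ν of length m and a list H of arrows b → c.
record ArrowPattern (k m : ℕ) : Set where
  constructor mkPat
  field
    str    : Vec (Fin k) m
    arrows : List (Fin k × Fin k)

StrictlyIncreasing : ∀ {a b} → (Fin a → Fin b) → Set
StrictlyIncreasing {a} f = ∀ (i j : Fin a) → i F.< j → f i F.< f j

Contains : ∀ {n k m} → ArrowPattern k m → Perm n → Set
Contains {n} {k} {m} α π =
  ∃[ x ] (StrictlyIncreasing {k} {n} x ×
    (∃[ t ] (StrictlyIncreasing {m} {n} t ×
       (∀ (j : Fin m) → lookup π (t j) ≡ x (lookup (ArrowPattern.str α) j)))) ×
    All (λ bc → HatMaps π (x (Data.Product.proj₁ bc)) (x (Data.Product.proj₂ bc)))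
        (ArrowPattern.arrows α))

Avoids : ∀ {n k m} → ArrowPattern k m → Perm n → Set
Avoids α π = ¬ Contains α π

AvoidCountIs : ∀ {k m} → ArrowPattern k m → ℕ → ℕ → Set
AvoidCountIs α n N =
  Σ (List (Perm n)) λ L →
    Unique L ×
    All (λ π → IsPerm π × Avoids α π) L ×
    (∀ (π : Perm n) → IsPerm π → Avoids α π → π ∈ L) ×
    (length L ≡ N)

{-# OPTIONS --safe #-}
-- Cutting the one-line notation of π before each left-to-right maximum yields the cycles of
-- π̂ = θ⁻¹(π) in standard form, so the arrows u → π̂(u) can be read off π: every entry points to
-- the next entry of its block, the last entry of a block back to the block's first one.  Every
-- value occurs in π, so the letter a plays no role, and π avoids (a; b→c) iff none of these
-- arrows has the shape that x_b → x_c has for x₁ < x₂ < x₃ (for b→c = 1→3: u + 1 < v).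
-- Split π around its maximum n-1 as pre, n-1, post; its arrows are those of pre together with
-- the cycle n-1 → post → n-1.  For b→c among 1→2, 2→1 both parts must then be monotone, and π
-- is fixed by the set of values in post: 2^(n-1) choices.  For the other four either post is
-- empty and pre is an avoider of size n-1, or post is forced by a smaller avoider (1→3, 3→1)
-- or by a subset of [1, n-1) (2→3, 3→2), and in each case the count doubles.
module Submission where

open import Data.Empty using (⊥; ⊥-elim)
open import Data.Nat as ℕ using (ℕ; zero; suc; _+_; _∸_; _^_; _≤_; _<_; _≤?_; z≤n; s≤s)
import Data.Nat.Properties as ℕ
open import Data.Nat.DivMod using (_mod_; m<n⇒m%n≡m)
open import Data.Product as Prod using (∃-syntax; _×_; _,_; proj₁; proj₂)
open import Data.Sum as Sum using (_⊎_; inj₁; inj₂)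
open import Function using (_∘_; _on_; flip)
open import Function.Bundles using (mk⇔)
open import Relation.Binary.PropositionalEquality
open import Relation.Nullary using (¬_; yes; no)

open import Data.List as List
  using (List; []; _∷_; _++_; _∷ʳ_; map; concatMap; length; applyUpTo; upTo; reverse; initLast; _∷ʳ′_)
open import Data.List.Properties
  using ( ++-assoc; ++-identityʳ; ∷-injective; ∷ʳ-injectiveˡ; map-++; map-upTo; map-applyUpTo; length-++; length-map
        ; length-upTo; upTo-∷ʳ; unfold-reverse; reverse-involutive; reverse-injective)
open import Data.List.Membership.Propositional using (_∈_)
open import Data.List.Membership.Propositional.Properties
  using (∈-map⁺; ∈-map⁻; ∈-upTo⁺; ∈-upTo⁻; ∈-++⁺ˡ; ∈-++⁺ʳ; ∈-++⁻; ∈-∃++)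
open import Data.List.Membership.Propositional.Properties.WithK using (unique∧set⇒bag)
open import Data.List.Relation.Unary.Any using (here; there)
open import Data.List.Relation.Unary.All as All using (All; []; _∷_)
import Data.List.Relation.Unary.All.Properties as All
open import Data.List.Relation.Unary.AllPairs as AllPairs using (AllPairs; []; _∷_)
import Data.List.Relation.Unary.AllPairs.Properties as AllPairs
open import Data.List.Relation.Unary.Linked as Linked using (Linked; []; [-]; _∷_)
import Data.List.Relation.Unary.Linked.Properties as Linked
open import Data.List.Relation.Unary.Unique.Propositional using (Unique)
import Data.List.Relation.Unary.Unique.Propositional.Properties as Unique
open import Data.List.Relation.Binary.Permutation.Propositional
  using (_↭_; prep; ↭-refl; ↭-sym; ↭-trans; ↭⇒↭ₛ; module PermutationReasoning)
import Data.List.Relation.Binary.Permutation.Propositional.Properties as ↭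
import Data.List.Relation.Binary.Permutation.Setoid.Properties as ↭ₛ
open import Data.List.Relation.Binary.BagAndSetEquality using (∼bag⇒↭)
open import Data.List.Relation.Ternary.Interleaving.Propositional
  using (Interleaving; []; consˡ; consʳ; toPermutation)

open import Data.Fin as Fin using (Fin; toℕ)
open import Data.Fin.Patterns using (0F; 1F; 2F)
open import Data.Fin.Properties as Fin
  using (toℕ-injective; toℕ<n; toℕ-fromℕ<; punchOut-injective; pigeonhole; any?)
open import Data.Vec as Vec using (Vec; lookup; tabulate; toList)
open import Data.Vec.Properties using (lookup∘tabulate)
open import Data.Vec.Membership.Propositional.Properties using (∈-toList⁺; ∈-lookup)

open import Defs

Unique-resp-↭ : ∀ {A : Set} {xs ys : List A} → xs ↭ ys → Unique xs → Unique ys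
Unique-resp-↭ xs↭ys = ↭ₛ.Unique-resp-↭ (setoid _) (↭⇒↭ₛ xs↭ys)

unique-map-injective : ∀ {A B : Set} (f : A → B) {xs x y} → Unique (map f xs) → x ∈ xs → y ∈ xs → f x ≡ f y →
                       x ≡ y
unique-map-injective f _ (here refl) (here refl) _ = refl
unique-map-injective f (fx∉ ∷ _) (here refl) (there y∈) fx≡fy = ⊥-elim (All.lookup fx∉ (∈-map⁺ f y∈) fx≡fy)
unique-map-injective f (fy∉ ∷ _) (there x∈) (here refl) fx≡fy = ⊥-elim (All.lookup fy∉ (∈-map⁺ f x∈) (sym fx≡fy))
unique-map-injective f (_ ∷ unique) (there x∈) (there y∈) fx≡fy = unique-map-injective f unique x∈ y∈ fx≡fy

unique-map⁺ : ∀ {A B : Set} (f : A → B) {xs} → (∀ {x y} → x ∈ xs → y ∈ xs → f x ≡ f y → x ≡ y) → Unique xs →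
              Unique (map f xs)
unique-map⁺ f injective [] = []
unique-map⁺ f injective (x∉ ∷ unique) =
  All.map⁺ (All.tabulate λ y∈ fx≡fy → All.lookup x∉ y∈ (injective (here refl) (there y∈) fx≡fy))
  ∷ unique-map⁺ f (λ x∈ y∈ → injective (there x∈) (there y∈)) unique

unique-++⁻ : ∀ {A : Set} (xs : List A) {ys} → Unique (xs ++ ys) → Unique xs × Unique ys
unique-++⁻ [] unique = [] , unique
unique-++⁻ (x ∷ xs) (x∉ ∷ unique) = Prod.map₁ (All.++⁻ˡ xs x∉ ∷_) (unique-++⁻ xs unique)

unique-++-disjoint : ∀ {A : Set} xs {ys} {y : A} → Unique (xs ++ ys) → y ∈ ys → All (_≢ y) xs
unique-++-disjoint [] _ _ = []
unique-++-disjoint (x ∷ xs) (x∉ ∷ unique) y∈ = All.lookup x∉ (∈-++⁺ʳ xs y∈) ∷ unique-++-disjoint xs unique y∈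

allPairs-reverse : ∀ {A : Set} {R : A → A → Set} {xs} → AllPairs R xs → AllPairs (flip R) (reverse xs)
allPairs-reverse [] = []
allPairs-reverse {R = R} {x ∷ xs} (x-R ∷ pairs) = subst (AllPairs (flip R)) (sym (unfold-reverse x xs))
  (AllPairs.++⁺ (allPairs-reverse pairs) ([] ∷ []) (All.map (_∷ []) (↭.All-resp-↭ (↭-sym (↭.↭-reverse xs)) x-R)))

module _ {A : Set} {R : A → A → Set} where

  linked-cons : ∀ {x xs} → All (R x) xs → Linked R xs → Linked R (x ∷ xs)
  linked-cons [] [] = [-]
  linked-cons (r ∷ _) linked = r ∷ linked

  linked-refine : ∀ {P : A → Set} {S : A → A → Set} {xs} → (∀ {a b} → P a → P b → a ≢ b → R a b → S a b) →
                  All P xs → Unique xs → Linked R xs → Linked S xs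
  linked-refine refine _ _ [] = []
  linked-refine refine _ _ [-] = [-]
  linked-refine refine (pa ∷ all-P@(pb ∷ _)) ((a≢b ∷ _) ∷ unique) (r ∷ linked) =
    refine pa pb a≢b r ∷ linked-refine refine all-P unique linked

split-injective : ∀ {m : ℕ} A A′ {B B′} → All (_≢ m) A → All (_≢ m) A′ → A ++ m ∷ B ≡ A′ ++ m ∷ B′ →
                  A ≡ A′ × B ≡ B′
split-injective [] [] _ _ refl = refl , refl
split-injective [] (_ ∷ _) _ (m≢m ∷ _) refl = ⊥-elim (m≢m refl)
split-injective (_ ∷ _) [] (m≢m ∷ _) _ refl = ⊥-elim (m≢m refl)
split-injective (a ∷ A) (a′ ∷ A′) (_ ∷ A≢m) (_ ∷ A′≢m) eq with refl , eq′ ← ∷-injective eq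
  with refl , refl ← split-injective A A′ A≢m A′≢m eq′ = refl , refl

↭-∷ʳ-cancel : ∀ {A : Set} {xs ys : List A} {x} → xs ∷ʳ x ↭ ys ∷ʳ x → xs ↭ ys
↭-∷ʳ-cancel {xs = xs} {ys} p = subst₂ _↭_ (++-identityʳ xs) (++-identityʳ ys) (↭.drop-mid xs ys p)

∷ʳ≢[] : ∀ {A : Set} (xs : List A) {x} → xs ∷ʳ x ≢ []
∷ʳ≢[] [] ()
∷ʳ≢[] (_ ∷ _) ()

length-map-++ : ∀ {A B : Set} (f : A → B) (L : List A) {M : List B} {k} →
                length L ≡ 2 ^ k → length M ≡ 2 ^ k → length (map f L ++ M) ≡ 2 ^ suc k
length-map-++ f L {M} {k} |L| |M| = begin
  length (map f L ++ M)          ≡⟨ length-++ (map f L) ⟩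
  length (map f L) + length M    ≡⟨ cong₂ _+_ (trans (length-map f L) |L|) |M| ⟩
  2 ^ k + 2 ^ k                  ≡⟨ cong (2 ^ k +_) (ℕ.+-identityʳ _) ⟨
  2 ^ suc k                      ∎
  where open ≡-Reasoning

-- Enumerations, and the 2^k interleavings of a list

record Enumerates {A : Set} (P : A → Set) (L : List A) : Set where
  field
    unique   : Unique L
    sound    : ∀ {x} → x ∈ L → P x
    complete : ∀ {x} → P x → x ∈ L

module _ {A B : Set} {P : A → Set} {L : List A} where

  enumerates-map : ∀ {Q : B → Set} (f : A → B) → Enumerates P L →
                   (∀ {x y} → P x → P y → f x ≡ f y → x ≡ y) →
                   (∀ {x} → P x → Q (f x)) → (∀ {y} → Q y → ∃[ x ] P x × y ≡ f x) →
                   Enumerates Q (map f L)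
  enumerates-map {Q} f enum injective f-sound f-complete = record
    { unique   = unique-map⁺ f (λ x∈ y∈ → injective (sound x∈) (sound y∈)) unique
    ; sound    = image-sound
    ; complete = image-complete
    }
    where
    open Enumerates enum
    image-sound : ∀ {y} → y ∈ map f L → Q y
    image-sound y∈ with x , x∈ , refl ← ∈-map⁻ f y∈ = f-sound (sound x∈)
    image-complete : ∀ {y} → Q y → y ∈ map f L
    image-complete qy with x , px , refl ← f-complete qy = ∈-map⁺ f (complete px)

module _ {A : Set} {P Q : A → Set} {L M : List A} where

  enumerates-++ : Enumerates P L → Enumerates Q M → (∀ {x} → P x → Q x → ⊥) →
                  Enumerates (λ x → P x ⊎ Q x) (L ++ M)
  enumerates-++ enumL enumM disjoint = record
    { unique   = Unique.++⁺ (unique enumL) (unique enumM)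
                   (λ (x∈L , x∈M) → disjoint (sound enumL x∈L) (sound enumM x∈M))
    ; sound    = λ x∈ → Sum.map (sound enumL) (sound enumM) (∈-++⁻ L x∈)
    ; complete = λ { (inj₁ px) → ∈-++⁺ˡ (complete enumL px) ; (inj₂ qx) → ∈-++⁺ʳ L (complete enumM qx) }
    }
    where open Enumerates

module _ {A : Set} {P Q : A → Set} {L : List A} where

  enumerates-⇔ : Enumerates P L → (∀ {x} → P x → Q x) → (∀ {x} → Q x → P x) → Enumerates Q L
  enumerates-⇔ enum to from = record { unique = unique ; sound = to ∘ sound ; complete = complete ∘ from }
    where open Enumerates enum

module _ {A : Set} where

  splits : List A → List (List A × List A)
  splits [] = ([] , []) ∷ []
  splits (z ∷ zs) = map (Prod.map₁ (z ∷_)) (splits zs) ++ map (Prod.map₂ (z ∷_)) (splits zs)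

  length-splits : ∀ zs → length (splits zs) ≡ 2 ^ length zs
  length-splits [] = refl
  length-splits (z ∷ zs) =
    length-map-++ _ (splits zs) {k = length zs} (length-splits zs) (trans (length-map _ (splits zs)) (length-splits zs))

  interleaving-All : ∀ {P : A → Set} {B C zs : List A} → Interleaving B C zs → All P zs → All P B × All P C
  interleaving-All {B = B} sp all-P = All.++⁻ B (↭.All-resp-↭ (toPermutation sp) all-P)

  ∈-splits⁺ : ∀ {B C zs : List A} → Interleaving B C zs → (B , C) ∈ splits zs
  ∈-splits⁺ [] = here refl
  ∈-splits⁺ (consˡ sp) = ∈-++⁺ˡ (∈-map⁺ _ (∈-splits⁺ sp))
  ∈-splits⁺ (consʳ sp) = ∈-++⁺ʳ _ (∈-map⁺ _ (∈-splits⁺ sp))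

  ∈-splits⁻ : ∀ {B C : List A} zs → (B , C) ∈ splits zs → Interleaving B C zs
  ∈-splits⁻ [] (here refl) = []
  ∈-splits⁻ (z ∷ zs) BC∈ with ∈-++⁻ (map (Prod.map₁ (z ∷_)) (splits zs)) BC∈
  ... | inj₁ BC∈ˡ with _ , BC∈′ , refl ← ∈-map⁻ _ BC∈ˡ = consˡ (∈-splits⁻ zs BC∈′)
  ... | inj₂ BC∈ʳ with _ , BC∈′ , refl ← ∈-map⁻ _ BC∈ʳ = consʳ (∈-splits⁻ zs BC∈′)

  splits-unique : ∀ zs → Unique zs → Unique (splits zs)
  splits-unique [] _ = [] ∷ []
  splits-unique (z ∷ zs) (z∉ ∷ unique) =
    Unique.++⁺ (unique-map⁺ _ (λ { {_ , _} {_ , _} _ _ refl → refl }) (splits-unique zs unique))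
               (unique-map⁺ _ (λ { {_ , _} {_ , _} _ _ refl → refl }) (splits-unique zs unique))
               disjoint
    where
    disjoint : ∀ {BC} → ¬ (BC ∈ map (Prod.map₁ (z ∷_)) (splits zs) × BC ∈ map (Prod.map₂ (z ∷_)) (splits zs))
    disjoint (BC∈ˡ , BC∈ʳ)
      with (_ , C) , C∈ , refl ← ∈-map⁻ _ BC∈ˡ
      with _ , BC∈′ , refl ← ∈-map⁻ _ BC∈ʳ
      with z≢z ∷ _ ← proj₂ (interleaving-All (∈-splits⁻ zs C∈) z∉) = z≢z refl

  splits-enumerates : ∀ zs → Unique zs → Enumerates (λ (B , C) → Interleaving B C zs) (splits zs)
  splits-enumerates zs unique = record
    { unique = splits-unique zs unique ; sound = ∈-splits⁻ zs ; complete = ∈-splits⁺ }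

head-least : ∀ {x y xs} → AllPairs _<_ (x ∷ xs) → y ∈ x ∷ xs → x ≤ y
head-least _ (here refl) = ℕ.≤-refl
head-least (x< ∷ _) (there y∈) = ℕ.<⇒≤ (All.lookup x< y∈)

interleaving-sorted : ∀ {B C zs} → Interleaving B C zs → AllPairs _<_ zs → AllPairs _<_ B × AllPairs _<_ C
interleaving-sorted [] [] = [] , []
interleaving-sorted (consˡ sp) (z< ∷ sorted) =
  Prod.map₁ (proj₁ (interleaving-All sp z<) ∷_) (interleaving-sorted sp sorted)
interleaving-sorted (consʳ sp) (z< ∷ sorted) =
  Prod.map₂ (proj₂ (interleaving-All sp z<) ∷_) (interleaving-sorted sp sorted)

↭-interleaving : ∀ {B C zs} → AllPairs _<_ B → AllPairs _<_ C → AllPairs _<_ zs → B ++ C ↭ zs →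
                 Interleaving B C zs
↭-interleaving {[]} {[]} {[]} _ _ _ _ = []
↭-interleaving {_ ∷ _} {_} {[]} _ _ _ p with () ← ↭.↭-empty-inv p
↭-interleaving {[]} {_ ∷ _} {[]} _ _ _ p with () ← ↭.↭-empty-inv p
↭-interleaving {B} {C} {z ∷ zs} _ _ _ p with ∈-++⁻ B (↭.∈-resp-↭ (↭-sym p) (here refl))
↭-interleaving {b ∷ B} {C} {z ∷ zs} sorted-B sorted-C sorted-zs p | inj₁ z∈B
  with refl ← ℕ.≤-antisym (head-least sorted-B z∈B) (head-least sorted-zs (↭.∈-resp-↭ p (here refl)))
  = consˡ (↭-interleaving (AllPairs.tail sorted-B) sorted-C (AllPairs.tail sorted-zs) (↭.drop-∷ p))
↭-interleaving {B} {c ∷ C} {z ∷ zs} sorted-B sorted-C sorted-zs p | inj₂ z∈C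
  with refl ← ℕ.≤-antisym (head-least sorted-C z∈C) (head-least sorted-zs (↭.∈-resp-↭ p (∈-++⁺ʳ B (here refl))))
  = consʳ (↭-interleaving sorted-B (AllPairs.tail sorted-C) (AllPairs.tail sorted-zs) (↭.drop-mid B [] p))

length-map-splits : ∀ {A B : Set} (f : List A × List A → B) zs {k} → length zs ≡ k →
                    length (map f (splits zs)) ≡ 2 ^ k
length-map-splits f zs refl = trans (length-map f (splits zs)) (length-splits zs)

-- Blocks of left-to-right maxima, and the arrows of a permutation

-- Entries are compared through key, so that the same blocks serve the one-line notation of a
-- permutation (Fin n, key = toℕ) and the lists of naturals that are counted (key = id).
module Blocks {A : Set} (key : A → ℕ) where

  Block : Set
  Block = A × List A

  Bounded : Block → Set
  Bounded (h , r) = All (λ x → key x ≤ key h) r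

  Standard : List Block → Set
  Standard bs = All Bounded bs × Linked (_<_ on key) (map proj₁ bs)

  flatten : List Block → List A
  flatten [] = []
  flatten ((h , r) ∷ bs) = h ∷ r ++ flatten bs

  -- blocksFrom h xs: the rest of the block opened by h, and the blocks that follow; a new block
  -- opens at every entry above the current leader.
  blocksFrom : A → List A → List A × List Block
  blocksFrom h [] = [] , []
  blocksFrom h (x ∷ xs) with key x ≤? key h
  ... | yes _ = Prod.map₁ (x ∷_) (blocksFrom h xs)
  ... | no _  = [] , (x , proj₁ (blocksFrom x xs)) ∷ proj₂ (blocksFrom x xs)

  blocks : List A → List Block
  blocks [] = []
  blocks (h ∷ xs) = (h , proj₁ (blocksFrom h xs)) ∷ proj₂ (blocksFrom h xs)

  blocksFrom-flatten : ∀ h xs → proj₁ (blocksFrom h xs) ++ flatten (proj₂ (blocksFrom h xs)) ≡ xs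
  blocksFrom-flatten h [] = refl
  blocksFrom-flatten h (x ∷ xs) with key x ≤? key h
  ... | yes _ = cong (x ∷_) (blocksFrom-flatten h xs)
  ... | no _  = cong (x ∷_) (blocksFrom-flatten x xs)

  flatten-blocks : ∀ xs → flatten (blocks xs) ≡ xs
  flatten-blocks [] = refl
  flatten-blocks (h ∷ xs) = cong (h ∷_) (blocksFrom-flatten h xs)

  blocksFrom-standard : ∀ h xs → Standard ((h , proj₁ (blocksFrom h xs)) ∷ proj₂ (blocksFrom h xs))
  blocksFrom-standard h [] = [] ∷ [] , [-]
  blocksFrom-standard h (x ∷ xs) with key x ≤? key h | blocksFrom-standard h xs | blocksFrom-standard x xs
  ... | yes x≤h | r ∷ bs , linked | _           = (x≤h ∷ r) ∷ bs , linked
  ... | no x≰h  | _                | bs , linked = [] ∷ bs , ℕ.≰⇒> x≰h ∷ linked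

  blocks-standard : ∀ xs → Standard (blocks xs)
  blocks-standard [] = [] , []
  blocks-standard (h ∷ xs) = blocksFrom-standard h xs

  blocksFrom-flatten⁻ : ∀ h r bs → Standard ((h , r) ∷ bs) → blocksFrom h (r ++ flatten bs) ≡ (r , bs)
  blocksFrom-flatten⁻ h (x ∷ r) bs ((x≤h ∷ bounded) ∷ bs-bounded , linked) with key x ≤? key h
  ... | yes _   = cong (Prod.map₁ (x ∷_)) (blocksFrom-flatten⁻ h r bs (bounded ∷ bs-bounded , linked))
  ... | no x≰h = ⊥-elim (x≰h x≤h)
  blocksFrom-flatten⁻ h [] [] _ = refl
  blocksFrom-flatten⁻ h [] ((h′ , r′) ∷ bs) (_ ∷ bs-bounded , h<h′ ∷ linked) with key h′ ≤? key h
  ... | yes h′≤h = ⊥-elim (ℕ.<⇒≱ h<h′ h′≤h)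
  ... | no _     = cong (λ (r , bs) → [] , (h′ , r) ∷ bs) (blocksFrom-flatten⁻ h′ r′ bs (bs-bounded , linked))

  blocks-flatten : ∀ bs → Standard bs → blocks (flatten bs) ≡ bs
  blocks-flatten [] _ = refl
  blocks-flatten ((h , r) ∷ bs) std = cong (λ (r , bs) → (h , r) ∷ bs) (blocksFrom-flatten⁻ h r bs std)

  chain : A → List A → A → List (A × A)
  chain x [] z = (x , z) ∷ []
  chain x (y ∷ ys) z = (x , y) ∷ chain y ys z

  cycleArrows : Block → List (A × A)
  cycleArrows (h , r) = chain h r h

  -- For the one-line notation xs of π, the arrows u → π̂(u).
  arrows : List A → List (A × A)
  arrows xs = concatMap cycleArrows (blocks xs)

  blocksFrom-++ : ∀ h r y ys → key h < key y → All (λ x → key x < key y) r →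
                  blocksFrom h (r ++ y ∷ ys) ≡ Prod.map₂ (_++ blocks (y ∷ ys)) (blocksFrom h r)
  blocksFrom-++ h [] y ys h<y _ with key y ≤? key h
  ... | yes y≤h = ⊥-elim (ℕ.<⇒≱ h<y y≤h)
  ... | no _    = refl
  blocksFrom-++ h (x ∷ r) y ys h<y (x<y ∷ r<y) with key x ≤? key h
  ... | yes _ = cong (Prod.map₁ (x ∷_)) (blocksFrom-++ h r y ys h<y r<y)
  ... | no _  = cong (λ (r′ , bs) → [] , (x , r′) ∷ bs) (blocksFrom-++ x r y ys x<y r<y)

  blocks-++ : ∀ xs y ys → All (λ x → key x < key y) xs → blocks (xs ++ y ∷ ys) ≡ blocks xs ++ blocks (y ∷ ys)
  blocks-++ [] y ys _ = refl
  blocks-++ (h ∷ r) y ys (h<y ∷ r<y) = cong (λ (r′ , bs) → (h , r′) ∷ bs) (blocksFrom-++ h r y ys h<y r<y)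

  blocksFrom-bounded : ∀ h r → Bounded (h , r) → blocksFrom h r ≡ (r , [])
  blocksFrom-bounded h [] _ = refl
  blocksFrom-bounded h (x ∷ r) (x≤h ∷ r≤h) with key x ≤? key h
  ... | yes _   = cong (Prod.map₁ (x ∷_)) (blocksFrom-bounded h r r≤h)
  ... | no x≰h = ⊥-elim (x≰h x≤h)

  blocksFrom-sorted : ∀ h xs → Linked (_<_ on key) (h ∷ xs) → blocksFrom h xs ≡ ([] , map (_, []) xs)
  blocksFrom-sorted h [] _ = refl
  blocksFrom-sorted h (x ∷ xs) (h<x ∷ sorted) with key x ≤? key h
  ... | yes x≤h = ⊥-elim (ℕ.<⇒≱ h<x x≤h)
  ... | no _    = cong (λ (r , bs) → [] , (x , r) ∷ bs) (blocksFrom-sorted x xs sorted)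

  chain-sources : ∀ x ys z → map proj₁ (chain x ys z) ≡ x ∷ ys
  chain-sources x [] z = refl
  chain-sources x (y ∷ ys) z = cong (x ∷_) (chain-sources y ys z)

  chain-targets : ∀ x ys z → map proj₂ (chain x ys z) ≡ ys ∷ʳ z
  chain-targets x [] z = refl
  chain-targets x (y ∷ ys) z = cong (y ∷_) (chain-targets y ys z)

  chain-∷ʳ : ∀ x ys y z → chain x (ys ∷ʳ y) z ≡ chain x ys y ∷ʳ (y , z)
  chain-∷ʳ x [] y z = refl
  chain-∷ʳ x (w ∷ ys) y z = cong ((x , w) ∷_) (chain-∷ʳ w ys y z)

  module _ {P : A × A → Set} where

    chain⁻ : ∀ {x ys z} → All P (chain x ys z) → Linked (λ a b → P (a , b)) (x ∷ ys)
    chain⁻ {ys = []} _ = [-]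
    chain⁻ {ys = y ∷ ys} (p ∷ ps) = p ∷ chain⁻ ps

    chain⁺ : ∀ {x ys z} → Linked (λ a b → P (a , b)) (x ∷ ys) → All (λ a → P (a , z)) (x ∷ ys) →
             All P (chain x ys z)
    chain⁺ {ys = []} _ (p ∷ []) = p ∷ []
    chain⁺ {ys = y ∷ ys} (p ∷ ps) (_ ∷ qs) = p ∷ chain⁺ ps qs

    chain-swapˡ : ∀ {x x′ ys z} → All P (chain x ys z) → All (λ b → P (x′ , b)) (z ∷ ys) →
                  All P (chain x′ ys z)
    chain-swapˡ {ys = []} _ (p ∷ []) = p ∷ []
    chain-swapˡ {ys = y ∷ ys} (_ ∷ ps) (_ ∷ p ∷ _) = p ∷ ps

    chain-swapʳ : ∀ {x ys z z′} → All P (chain x ys z) → All (λ a → P (a , z′)) (x ∷ ys) →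
                  All P (chain x ys z′)
    chain-swapʳ {ys = []} _ (p ∷ []) = p ∷ []
    chain-swapʳ {ys = y ∷ ys} (p ∷ ps) (_ ∷ qs) = p ∷ chain-swapʳ ps qs

  arrows-++ : ∀ xs y ys → All (λ x → key x < key y) xs → arrows (xs ++ y ∷ ys) ≡ arrows xs ++ arrows (y ∷ ys)
  arrows-++ xs y ys xs<y = begin
    concatMap cycleArrows (blocks (xs ++ y ∷ ys))         ≡⟨ cong (concatMap cycleArrows) (blocks-++ xs y ys xs<y) ⟩
    concatMap cycleArrows (blocks xs ++ blocks (y ∷ ys))  ≡⟨ concatMap-++ (blocks xs) (blocks (y ∷ ys)) ⟩
    arrows xs ++ arrows (y ∷ ys)                          ∎
    where
    open ≡-Reasoning
    concatMap-++ : ∀ bs cs →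
                   concatMap cycleArrows (bs ++ cs) ≡ concatMap cycleArrows bs ++ concatMap cycleArrows cs
    concatMap-++ [] cs = refl
    concatMap-++ (b ∷ bs) cs =
      trans (cong (cycleArrows b ++_) (concatMap-++ bs cs)) (sym (++-assoc (cycleArrows b) _ _))

  arrows-bounded : ∀ h r → Bounded (h , r) → arrows (h ∷ r) ≡ chain h r h
  arrows-bounded h r bounded rewrite blocksFrom-bounded h r bounded = ++-identityʳ (chain h r h)

  arrows-sorted : ∀ xs → Linked (_<_ on key) xs → arrows xs ≡ map (λ x → x , x) xs
  arrows-sorted [] _ = refl
  arrows-sorted (h ∷ xs) sorted rewrite blocksFrom-sorted h xs sorted = cong ((h , h) ∷_) (singletons xs)
    where
    singletons : ∀ xs → concatMap cycleArrows (map (_, []) xs) ≡ map (λ x → x , x) xs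
    singletons [] = refl
    singletons (x ∷ xs) = cong ((x , x) ∷_) (singletons xs)

  arrows-sources : ∀ xs → map proj₁ (arrows xs) ≡ xs
  arrows-sources xs = trans (sources (blocks xs)) (flatten-blocks xs)
    where
    sources : ∀ bs → map proj₁ (concatMap cycleArrows bs) ≡ flatten bs
    sources [] = refl
    sources ((h , r) ∷ bs) = begin
      map proj₁ (chain h r h ++ concatMap cycleArrows bs)
        ≡⟨ map-++ proj₁ (chain h r h) _ ⟩
      map proj₁ (chain h r h) ++ map proj₁ (concatMap cycleArrows bs)
        ≡⟨ cong₂ _++_ (chain-sources h r h) (sources bs) ⟩
      h ∷ r ++ flatten bs
        ∎
      where open ≡-Reasoning

  arrows-targets : ∀ xs → map proj₂ (arrows xs) ↭ xs
  arrows-targets xs = subst (map proj₂ (arrows xs) ↭_) (flatten-blocks xs) (targets (blocks xs))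
    where
    targets : ∀ bs → map proj₂ (concatMap cycleArrows bs) ↭ flatten bs
    targets [] = ↭-refl
    targets ((h , r) ∷ bs) = begin
      map proj₂ (chain h r h ++ concatMap cycleArrows bs)
        ≡⟨ map-++ proj₂ (chain h r h) _ ⟩
      map proj₂ (chain h r h) ++ map proj₂ (concatMap cycleArrows bs)
        ≡⟨ cong (_++ _) (chain-targets h r h) ⟩
      (r ∷ʳ h) ++ map proj₂ (concatMap cycleArrows bs)
        ↭⟨ ↭.++⁺ (↭-sym (↭.∷↭∷ʳ h r)) (targets bs) ⟩
      h ∷ r ++ flatten bs
        ∎
      where open PermutationReasoning

module _ {A : Set} (key : A → ℕ) where
  open Blocks key
  private module ℕB = Blocks {ℕ} (λ x → x)

  keyBlock : Block → ℕB.Block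
  keyBlock = Prod.map key (map key)

  blocksFrom-map : ∀ h xs →
                   ℕB.blocksFrom (key h) (map key xs) ≡ Prod.map (map key) (map keyBlock) (blocksFrom h xs)
  blocksFrom-map h [] = refl
  blocksFrom-map h (x ∷ xs) with key x ≤? key h
  ... | yes _ = cong (Prod.map₁ (key x ∷_)) (blocksFrom-map h xs)
  ... | no _  = cong (λ (r , bs) → [] , (key x , r) ∷ bs) (blocksFrom-map x xs)

  blocks-map : ∀ xs → ℕB.blocks (map key xs) ≡ map keyBlock (blocks xs)
  blocks-map [] = refl
  blocks-map (h ∷ xs) = cong (λ (r , bs) → (key h , r) ∷ bs) (blocksFrom-map h xs)

  chain-map : ∀ x ys z → ℕB.chain (key x) (map key ys) (key z) ≡ map (Prod.map key key) (chain x ys z)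
  chain-map x [] z = refl
  chain-map x (y ∷ ys) z = cong ((key x , key y) ∷_) (chain-map y ys z)

  arrows-map : ∀ xs → ℕB.arrows (map key xs) ≡ map (Prod.map key key) (arrows xs)
  arrows-map xs = trans (cong (concatMap ℕB.cycleArrows) (blocks-map xs)) (go (blocks xs))
    where
    go : ∀ bs → concatMap ℕB.cycleArrows (map keyBlock bs) ≡ map (Prod.map key key) (concatMap cycleArrows bs)
    go [] = refl
    go ((h , r) ∷ bs) = trans (cong₂ _++_ (chain-map h r h) (go bs)) (sym (map-++ _ (chain h r h) _))

module _ {A : Set} where

  lookup∈toList : ∀ {k} (v : Vec A k) i → lookup v i ∈ toList v
  lookup∈toList v i = ∈-toList⁺ (∈-lookup i v)

  ∈toList⇒lookup : ∀ {k} (v : Vec A k) {x} → x ∈ toList v → ∃[ i ] lookup v i ≡ x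
  ∈toList⇒lookup (y Vec.∷ v) (here refl) = Fin.zero , refl
  ∈toList⇒lookup (y Vec.∷ v) (there x∈) = let i , vi≡x = ∈toList⇒lookup v x∈ in Fin.suc i , vi≡x

  injective⇒unique : ∀ {k} (v : Vec A k) → (∀ i j → lookup v i ≡ lookup v j → i ≡ j) → Unique (toList v)
  injective⇒unique Vec.[] _ = []
  injective⇒unique (x Vec.∷ v) inj =
    All.tabulate (λ y∈ x≡y → let i , vi≡y = ∈toList⇒lookup v y∈ in
                             Fin.0≢1+n (inj Fin.zero (Fin.suc i) (trans x≡y (sym vi≡y))))
    ∷ injective⇒unique v (λ i j vi≡vj → Fin.suc-injective (inj (Fin.suc i) (Fin.suc j) vi≡vj))

  unique⇒injective : ∀ {k} (v : Vec A k) → Unique (toList v) → ∀ i j → lookup v i ≡ lookup v j → i ≡ j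
  unique⇒injective (x Vec.∷ v) _ Fin.zero Fin.zero _ = refl
  unique⇒injective (x Vec.∷ v) (x∉ ∷ _) Fin.zero (Fin.suc j) x≡vj = ⊥-elim (All.lookup x∉ (lookup∈toList v j) x≡vj)
  unique⇒injective (x Vec.∷ v) (x∉ ∷ _) (Fin.suc i) Fin.zero vi≡x = ⊥-elim (All.lookup x∉ (lookup∈toList v i) (sym vi≡x))
  unique⇒injective (x Vec.∷ v) (_ ∷ unique) (Fin.suc i) (Fin.suc j) vi≡vj =
    cong Fin.suc (unique⇒injective v unique i j vi≡vj)

isPerm⇒∈ : ∀ {n} (π : Perm n) → IsPerm π → ∀ x → x ∈ toList π
isPerm⇒∈ {suc m} π inj x with any? (λ i → lookup π i Fin.≟ x)
... | yes (i , πi≡x) = subst (_∈ toList π) πi≡x (lookup∈toList π i)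
... | no ∄i = ⊥-elim (ℕ.<-irrefl (cong toℕ i≡j) i<j)
  where
  πi≢x : ∀ i → lookup π i ≢ x
  πi≢x i πi≡x = ∄i (i , πi≡x)
  collision = pigeonhole (ℕ.n<1+n m) (λ i → Fin.punchOut (πi≢x i ∘ sym))
  i = proj₁ collision
  j = proj₁ (proj₂ collision)
  i<j = proj₁ (proj₂ (proj₂ collision))
  i≡j = inj i j (punchOut-injective (πi≢x i ∘ sym) (πi≢x j ∘ sym) (proj₂ (proj₂ (proj₂ collision))))

-- Inverting the fundamental bijection

module FinBlocks {n : ℕ} = Blocks (toℕ {n})

module _ {n : ℕ} where
  open FinBlocks {n}

  MapsTo : Perm n → Fin n × Fin n → Set
  MapsTo σ (u , v) = lookup σ u ≡ v

  module _ (σ : Perm n) where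

    -- Stated for an arbitrary orbit g of σ rather than for iter σ · x: iter σ (suc k) x unfolds
    -- to σ (iter σ k x), whereas the induction needs iter σ k (σ x).
    orbit-mapsTo : ∀ (g : ℕ → Fin n) → (∀ k → g (suc k) ≡ lookup σ (g k)) → ∀ l →
                    All (MapsTo σ) (chain (g 0) (applyUpTo (g ∘ suc) l) (g (suc l)))
    orbit-mapsTo g orbit zero = sym (orbit 0) ∷ []
    orbit-mapsTo g orbit (suc l) = sym (orbit 0) ∷ orbit-mapsTo (g ∘ suc) (orbit ∘ suc) l

    mapsTo-orbit : ∀ (g : ℕ → Fin n) → (∀ k → g (suc k) ≡ lookup σ (g k)) → ∀ r z →
                    All (MapsTo σ) (chain (g 0) r z) → applyUpTo (g ∘ suc) (length r) ≡ r × g (suc (length r)) ≡ z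
    mapsTo-orbit g orbit [] z (σg≡z ∷ []) = refl , trans (orbit 0) σg≡z
    mapsTo-orbit g orbit (y ∷ r) z (σg≡y ∷ mapsTo)
      with refl ← trans (orbit 0) σg≡y
      with segment , last ← mapsTo-orbit (g ∘ suc) (orbit ∘ suc) r z mapsTo = cong (y ∷_) segment , last

    cycleBlock : Fin n × ℕ → Block
    cycleBlock c = proj₁ c , List.drop 1 (cycleList σ c)

    cycle-mapsTo : ∀ c → ValidCycle σ c → All (MapsTo σ) (cycleArrows (cycleBlock c))
    cycle-mapsTo (m , suc l) (_ , closed , _) =
      subst₂ (λ ys z → All (MapsTo σ) (chain m ys z)) (sym (map-applyUpTo suc orbit l)) closed
        (orbit-mapsTo orbit (λ _ → refl) l)
      where
      orbit = λ k → iter σ k m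

    cycle-bounded : ∀ c → ValidCycle σ c → Bounded (cycleBlock c)
    cycle-bounded (m , suc l) (_ , _ , below) = All.map⁺ (All.applyUpTo⁺₁ suc l (λ i<l → below _ (s≤s i<l)))

    flatten-cycleBlocks : ∀ C → All (ValidCycle σ) C → flatten (map cycleBlock C) ≡ concatMap (cycleList σ) C
    flatten-cycleBlocks [] [] = refl
    flatten-cycleBlocks ((m , suc l) ∷ C) (_ ∷ valid) = cong (m ∷_) (cong (_ ++_) (flatten-cycleBlocks C valid))

  theta-mapsTo : ∀ {σ π} → Theta σ π → All (MapsTo σ) (arrows (toList π))
  theta-mapsTo {σ} {π} (C , (valid , linked , _ , _) , concat≡π) =
    subst (λ bs → All (MapsTo σ) (concatMap cycleArrows bs)) (sym blocks≡) (all-mapsTo C valid)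
    where
    all-mapsTo : ∀ C → All (ValidCycle σ) C → All (MapsTo σ) (concatMap cycleArrows (map (cycleBlock σ) C))
    all-mapsTo [] [] = []
    all-mapsTo (c ∷ C) (v ∷ vs) = All.++⁺ (cycle-mapsTo σ c v) (all-mapsTo C vs)
    standard : Standard (map (cycleBlock σ) C)
    standard = All.map⁺ (All.map (cycle-bounded σ _) valid) , Linked.map⁺ (Linked.map⁺ linked)
    open ≡-Reasoning
    blocks≡ : blocks (toList π) ≡ map (cycleBlock σ) C
    blocks≡ = begin
      blocks (toList π)                           ≡⟨ cong blocks (sym concat≡π) ⟩
      blocks (concatMap (cycleList σ) C)          ≡⟨ cong blocks (sym (flatten-cycleBlocks σ C valid)) ⟩
      blocks (flatten (map (cycleBlock σ) C))     ≡⟨ blocks-flatten _ standard ⟩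
      map (cycleBlock σ) C                        ∎

  theta-covers : ∀ {σ π : Perm n} → Theta σ π → ∀ x → x ∈ toList π
  theta-covers (_ , (_ , _ , _ , cover) , concat≡π) x = subst (x ∈_) concat≡π (cover x)

  hatMaps⇒arrow : ∀ {π : Perm n} {u v} → HatMaps π u v → (u , v) ∈ arrows (toList π)
  hatMaps⇒arrow {π} {u} (σ , _ , θ , σu≡v)
    with (.u , w) , uw∈ , refl ← ∈-map⁻ proj₁ (subst (u ∈_) (sym (arrows-sources _)) (theta-covers θ u))
    = subst (λ v → (u , v) ∈ arrows (toList π)) (trans (sym (All.lookup (theta-mapsTo θ) uw∈)) σu≡v) uw∈

  target : List (Fin n × Fin n) → Fin n → Fin n
  target [] u = u
  target ((a , b) ∷ ps) u with u Fin.≟ a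
  ... | yes _ = b
  ... | no _  = target ps u

  target-∈ : ∀ ps {a b} → Unique (map proj₁ ps) → (a , b) ∈ ps → target ps a ≡ b
  target-∈ ((a , b) ∷ ps) _ (here refl) with a Fin.≟ a
  ... | yes _   = refl
  ... | no a≢a = ⊥-elim (a≢a refl)
  target-∈ ((a′ , b′) ∷ ps) {a} (a′∉ ∷ unique) (there ab∈) with a Fin.≟ a′
  ... | yes refl = ⊥-elim (All.lookup a′∉ (∈-map⁺ proj₁ ab∈) refl)
  ... | no _     = target-∈ ps unique ab∈

  hat : Perm n → Perm n
  hat π = tabulate (target (arrows (toList π)))

  module _ {π : Perm n} (perm : IsPerm π) where
    private
      xs = toList π
      σ = hat π
      unique-xs : Unique xs
      unique-xs = injective⇒unique π perm

    hat-mapsTo : All (MapsTo σ) (arrows xs)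
    hat-mapsTo = All.tabulate λ {(a , b)} ab∈ →
      trans (lookup∘tabulate _ a) (target-∈ _ (subst Unique (sym (arrows-sources xs)) unique-xs) ab∈)

    private
      arrow-from : ∀ u → ∃[ v ] (u , v) ∈ arrows xs × lookup σ u ≡ v
      arrow-from u
        with (.u , v) , uv∈ , refl ← ∈-map⁻ proj₁ (subst (u ∈_) (sym (arrows-sources xs)) (isPerm⇒∈ π perm u))
        = v , uv∈ , All.lookup hat-mapsTo uv∈

    hat-isPerm : IsPerm σ
    hat-isPerm i j σi≡σj
      with v , iv∈ , σi≡v ← arrow-from i
      with w , jw∈ , σj≡w ← arrow-from j
      = cong proj₁ (unique-map-injective proj₂ (Unique-resp-↭ (↭-sym (arrows-targets xs)) unique-xs) iv∈ jw∈
                     (trans (sym σi≡v) (trans σi≡σj σj≡w)))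

    private
      toCycle : Block → Fin n × ℕ
      toCycle (h , r) = h , suc (length r)

      block-cycle : ∀ h r → Bounded (h , r) → All (MapsTo σ) (chain h r h) →
                    ValidCycle σ (toCycle (h , r)) × cycleList σ (toCycle (h , r)) ≡ h ∷ r
      block-cycle h r bounded mapsTo = (s≤s z≤n , closed , below) , cycle≡
        where
        orbit = λ k → iter σ k h
        segment-closed = mapsTo-orbit σ orbit (λ _ → refl) r h mapsTo
        closed = proj₂ segment-closed
        cycle≡ : cycleList σ (toCycle (h , r)) ≡ h ∷ r
        cycle≡ = cong (h ∷_) (trans (map-applyUpTo suc orbit (length r)) (proj₁ segment-closed))
        below : ∀ k → k < suc (length r) → iter σ k h Fin.≤ h
        below k k<ℓ = All.lookup (ℕ.≤-refl ∷ bounded)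
          (subst (iter σ k h ∈_) cycle≡ (∈-map⁺ orbit (∈-upTo⁺ k<ℓ)))

      blocks-cycles : ∀ bs → All Bounded bs → All (MapsTo σ) (concatMap cycleArrows bs) →
                      All (ValidCycle σ) (map toCycle bs) × concatMap (cycleList σ) (map toCycle bs) ≡ flatten bs
      blocks-cycles [] [] _ = [] , refl
      blocks-cycles ((h , r) ∷ bs) (bounded ∷ bs-bounded) mapsTo
        with valid , cycle≡ ← block-cycle h r bounded (All.++⁻ˡ (chain h r h) mapsTo)
        with bs-valid , concat≡ ← blocks-cycles bs bs-bounded (All.++⁻ʳ (chain h r h) mapsTo)
        = valid ∷ bs-valid , cong₂ _++_ cycle≡ concat≡

    hat-theta : Theta σ π
    hat-theta = C , (valid , linked , unique , cover) , concat≡π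
      where
      bs = blocks xs
      std = blocks-standard xs
      C = map toCycle bs
      cycles = blocks-cycles bs (proj₁ std) hat-mapsTo
      valid = proj₁ cycles
      concat≡π : concatMap (cycleList σ) C ≡ xs
      concat≡π = trans (proj₂ cycles) (flatten-blocks xs)
      linked : Linked (λ p q → leader p Fin.< leader q) C
      linked = Linked.map⁺ (Linked.map⁻ (proj₂ std))
      unique = subst Unique (sym concat≡π) unique-xs
      cover = λ x → subst (x ∈_) (sym concat≡π) (isPerm⇒∈ π perm x)

  arrow⇒hatMaps : ∀ {π : Perm n} {u v} → IsPerm π → (u , v) ∈ arrows (toList π) → HatMaps π u v
  arrow⇒hatMaps {π} perm uv∈ =
    hat π , hat-isPerm {π} perm , hat-theta {π} perm , All.lookup (hat-mapsTo {π} perm) uv∈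

-- Containment of (a; b→c)

Realizes : ∀ {n} → Fin 3 → Fin 3 → Fin n → Fin n → Set
Realizes {n} b c u v = ∃[ x ] StrictlyIncreasing {3} {n} x × x b ≡ u × x c ≡ v

module _ {n : ℕ} (a b c : Fin 3) where
  open FinBlocks {n}

  private
    α = mkPat (a Vec.∷ Vec.[]) ((b , c) ∷ [])

  contains⇒arrow : ∀ {π : Perm n} → Contains α π →
                   ∃[ uv ] uv ∈ arrows (toList π) × Realizes b c (proj₁ uv) (proj₂ uv)
  contains⇒arrow (x , increasing , _ , hatMaps ∷ []) =
    (x b , x c) , hatMaps⇒arrow hatMaps , x , increasing , refl , refl

  arrow⇒contains : ∀ {π : Perm n} {u v} → IsPerm π → (u , v) ∈ arrows (toList π) → Realizes b c u v →
                   Contains α π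
  arrow⇒contains {π} perm uv∈ (x , increasing , refl , refl) =
    x , increasing , ((λ _ → position) , (λ { 0F 0F () }) , λ { 0F → at-position }) , arrow⇒hatMaps perm uv∈ ∷ []
    where
    found = ∈toList⇒lookup π (isPerm⇒∈ π perm (x a))
    position = proj₁ found
    at-position = proj₂ found

-- The arrows u → v (values below n) that some x₁ < x₂ < x₃ realises as x_b → x_c, for the six
-- pairs of distinct 0-based letters (b , c) = (0,1), (1,0), (1,2), (2,1), (0,2), (2,0).
RiseBelowTop FallBelowTop RiseAboveBottom FallAboveBottom LongRise LongFall : ℕ → ℕ → ℕ → Set
RiseBelowTop n u v = u < v × suc v < n
FallBelowTop n u v = v < u × suc u < n
RiseAboveBottom _ u v = 0 < u × u < v
FallAboveBottom _ u v = 0 < v × v < u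
LongRise _ u v = suc u < v
LongFall _ u v = suc v < u

module _ (n : ℕ) where

  riseBelowTop-irreflexive : ∀ x → ¬ RiseBelowTop n x x
  riseBelowTop-irreflexive x (x<x , _) = ℕ.<-irrefl refl x<x

  fallBelowTop-irreflexive : ∀ x → ¬ FallBelowTop n x x
  fallBelowTop-irreflexive x (x<x , _) = ℕ.<-irrefl refl x<x

  riseAboveBottom-irreflexive : ∀ x → ¬ RiseAboveBottom n x x
  riseAboveBottom-irreflexive x (_ , x<x) = ℕ.<-irrefl refl x<x

  fallAboveBottom-irreflexive : ∀ x → ¬ FallAboveBottom n x x
  fallAboveBottom-irreflexive x (_ , x<x) = ℕ.<-irrefl refl x<x

  longRise-irreflexive : ∀ x → ¬ LongRise n x x
  longRise-irreflexive x x+1<x = ℕ.<-irrefl refl (ℕ.<-trans (ℕ.n<1+n x) x+1<x)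

  longFall-irreflexive : ∀ x → ¬ LongFall n x x
  longFall-irreflexive x x+1<x = ℕ.<-irrefl refl (ℕ.<-trans (ℕ.n<1+n x) x+1<x)

module _ {n : ℕ} where

  triple : Fin n → Fin n → Fin n → Fin 3 → Fin n
  triple i j k 0F = i
  triple i j k 1F = j
  triple i j k 2F = k

  triple-increasing : ∀ {i j k} → toℕ i < toℕ j → toℕ j < toℕ k → StrictlyIncreasing (triple i j k)
  triple-increasing i<j j<k 0F 1F _ = i<j
  triple-increasing i<j j<k 0F 2F _ = ℕ.<-trans i<j j<k
  triple-increasing i<j j<k 1F 2F _ = j<k
  triple-increasing i<j j<k 1F 1F (s≤s ())
  triple-increasing i<j j<k 2F 1F (s≤s ())
  triple-increasing i<j j<k 2F 2F (s≤s (s≤s ()))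

  module _ {x : Fin 3 → Fin n} (increasing : StrictlyIncreasing x) where
    x₀<x₁ : toℕ (x 0F) < toℕ (x 1F)
    x₀<x₁ = increasing 0F 1F (s≤s z≤n)
    x₁<x₂ : toℕ (x 1F) < toℕ (x 2F)
    x₁<x₂ = increasing 1F 2F (s≤s (s≤s z≤n))
    suc-x₁<n : suc (toℕ (x 1F)) < n
    suc-x₁<n = ℕ.<-≤-trans (s≤s x₁<x₂) (toℕ<n (x 2F))
    0<x₁ : 0 < toℕ (x 1F)
    0<x₁ = ℕ.≤-<-trans z≤n x₀<x₁
    suc-x₀<x₂ : suc (toℕ (x 0F)) < toℕ (x 2F)
    suc-x₀<x₂ = ℕ.≤-<-trans x₀<x₁ x₁<x₂

  module _ {u v : Fin n} where

    realizes⇒riseBelowTop : Realizes 0F 1F u v → RiseBelowTop n (toℕ u) (toℕ v)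
    realizes⇒riseBelowTop (_ , inc , refl , refl) = x₀<x₁ inc , suc-x₁<n inc

    realizes⇒fallBelowTop : Realizes 1F 0F u v → FallBelowTop n (toℕ u) (toℕ v)
    realizes⇒fallBelowTop (_ , inc , refl , refl) = x₀<x₁ inc , suc-x₁<n inc

    realizes⇒riseAboveBottom : Realizes 1F 2F u v → RiseAboveBottom n (toℕ u) (toℕ v)
    realizes⇒riseAboveBottom (_ , inc , refl , refl) = 0<x₁ inc , x₁<x₂ inc

    realizes⇒fallAboveBottom : Realizes 2F 1F u v → FallAboveBottom n (toℕ u) (toℕ v)
    realizes⇒fallAboveBottom (_ , inc , refl , refl) = 0<x₁ inc , x₁<x₂ inc

    realizes⇒longRise : Realizes 0F 2F u v → LongRise n (toℕ u) (toℕ v)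
    realizes⇒longRise (_ , inc , refl , refl) = suc-x₀<x₂ inc

    realizes⇒longFall : Realizes 2F 0F u v → LongFall n (toℕ u) (toℕ v)
    realizes⇒longFall (_ , inc , refl , refl) = suc-x₀<x₂ inc

module _ {m : ℕ} {u v : Fin (suc m)} where

  private
    below-top : ∀ {w : Fin (suc m)} → suc (toℕ w) < suc m → toℕ w < toℕ (Fin.fromℕ m)
    below-top {w} w<m = subst (toℕ w <_) (sym (Fin.toℕ-fromℕ m)) (ℕ.≤-pred w<m)

  realizes⇐riseBelowTop : RiseBelowTop (suc m) (toℕ u) (toℕ v) → Realizes 0F 1F u v
  realizes⇐riseBelowTop (u<v , v<m) = triple u v (Fin.fromℕ m) , triple-increasing u<v (below-top v<m) , refl , refl

  realizes⇐fallBelowTop : FallBelowTop (suc m) (toℕ u) (toℕ v) → Realizes 1F 0F u v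
  realizes⇐fallBelowTop (v<u , u<m) = triple v u (Fin.fromℕ m) , triple-increasing v<u (below-top u<m) , refl , refl

  realizes⇐riseAboveBottom : RiseAboveBottom (suc m) (toℕ u) (toℕ v) → Realizes 1F 2F u v
  realizes⇐riseAboveBottom (0<u , u<v) = triple 0F u v , triple-increasing 0<u u<v , refl , refl

  realizes⇐fallAboveBottom : FallAboveBottom (suc m) (toℕ u) (toℕ v) → Realizes 2F 1F u v
  realizes⇐fallAboveBottom (0<v , v<u) = triple 0F v u , triple-increasing 0<v v<u , refl , refl

  private
    between : ∀ {i k : Fin (suc m)} → suc (toℕ i) < toℕ k → ∃[ j ] toℕ i < toℕ j × toℕ j < toℕ k
    between {i} {k} i+1<k =
      Fin.fromℕ< i+1<n , subst (toℕ i <_) (sym j≡) ℕ.≤-refl , subst (_< toℕ k) (sym j≡) i+1<k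
      where
      i+1<n = ℕ.<-trans i+1<k (toℕ<n k)
      j≡ = toℕ-fromℕ< i+1<n

  realizes⇐longRise : LongRise (suc m) (toℕ u) (toℕ v) → Realizes 0F 2F u v
  realizes⇐longRise u+1<v with w , u<w , w<v ← between u+1<v =
    triple u w v , triple-increasing u<w w<v , refl , refl

  realizes⇐longFall : LongFall (suc m) (toℕ u) (toℕ v) → Realizes 2F 0F u v
  realizes⇐longFall v+1<u with w , v<w , w<u ← between v+1<u =
    triple v w u , triple-increasing v<w w<u , refl , refl

-- Arrangements of [0, n) split at their maximum

open Blocks {ℕ} (λ x → x)

upTo-sorted : ∀ m → AllPairs _<_ (upTo m)
upTo-sorted m = Linked.Linked⇒AllPairs ℕ.<-trans (Linked.applyUpTo⁺₂ (λ i → i) m (λ i → ℕ.n<1+n i))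

upTo-below : ∀ m → All (_< m) (upTo m)
upTo-below m = All.tabulate ∈-upTo⁻

↭upTo⇒< : ∀ {m ys} → ys ↭ upTo m → All (_< m) ys
↭upTo⇒< p = All.tabulate (λ y∈ → ∈-upTo⁻ (↭.∈-resp-↭ p y∈))

↭upTo⇒unique : ∀ {m ys} → ys ↭ upTo m → Unique ys
↭upTo⇒unique {m} p = Unique-resp-↭ (↭-sym p) (Unique.upTo⁺ m)

AroundMax : (List ℕ → List ℕ → Set) → ℕ → List ℕ → Set
AroundMax R m ys = ∃[ pre ] ∃[ post ] ys ≡ pre ++ m ∷ post × R pre post

join-at-max⁻ : ∀ {m} pre post → pre ++ m ∷ post ↭ upTo (suc m) → pre ++ post ↭ upTo m
join-at-max⁻ {m} pre post p =
  subst (pre ++ post ↭_) (++-identityʳ (upTo m))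
    (↭.drop-mid pre (upTo m) (subst (pre ++ m ∷ post ↭_) (sym (upTo-∷ʳ m)) p))

split-at-max : ∀ {m ys} → ys ↭ upTo (suc m) → AroundMax (λ pre post → pre ++ post ↭ upTo m) m ys
split-at-max {m} p with pre , post , refl ← ∈-∃++ (↭.∈-resp-↭ (↭-sym p) (∈-upTo⁺ (ℕ.n<1+n m))) =
  pre , post , refl , join-at-max⁻ pre post p

join-at-max : ∀ {m} pre post → pre ++ post ↭ upTo m → pre ++ m ∷ post ↭ upTo (suc m)
join-at-max {m} pre post p = begin
  pre ++ m ∷ post  ↭⟨ ↭.shift m pre post ⟩
  m ∷ pre ++ post  ↭⟨ prep m p ⟩
  m ∷ upTo m       ↭⟨ ↭.∷↭∷ʳ m (upTo m) ⟩
  upTo m ∷ʳ m      ≡⟨ upTo-∷ʳ m ⟩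
  upTo (suc m)     ∎
  where open PermutationReasoning

split-below : ∀ {m} pre {post} → pre ++ post ↭ upTo m → All (_< m) pre × All (_< m) post
split-below pre p = All.++⁻ pre (↭upTo⇒< p)

split-unique : ∀ {m} pre {post} → pre ++ post ↭ upTo m → Unique pre × Unique post
split-unique pre p = unique-++⁻ pre (↭upTo⇒unique p)

positives : ℕ → List ℕ
positives k = map suc (upTo k)

upTo-suc : ∀ k → upTo (suc k) ≡ 0 ∷ positives k
upTo-suc k = cong (0 ∷_) (sym (map-upTo suc k))

positives-sorted : ∀ k → AllPairs _<_ (positives k)
positives-sorted k = AllPairs.map⁺ (AllPairs.map s≤s (upTo-sorted k))

positives-unique : ∀ k → Unique (positives k)
positives-unique k = Unique.map⁺ ℕ.suc-injective (Unique.upTo⁺ k)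

positives-bounds : ∀ k → All (λ x → 0 < x × x < suc k) (positives k)
positives-bounds k = All.map⁺ (All.map (λ x<k → s≤s z≤n , s≤s x<k) (upTo-below k))

positives-length : ∀ k → length (positives k) ≡ k
positives-length k = trans (length-map suc (upTo k)) (length-upTo k)

ArrowsAvoid : (ℕ → ℕ → Set) → List ℕ → Set
ArrowsAvoid F ys = All (λ (u , v) → ¬ F u v) (arrows ys)

AvoidingArrangement : (ℕ → ℕ → Set) → ℕ → List ℕ → Set
AvoidingArrangement F n ys = ys ↭ upTo n × ArrowsAvoid F ys

arrows-at-max : ∀ {m} pre post → pre ++ post ↭ upTo m →
                arrows (pre ++ m ∷ post) ≡ arrows pre ++ chain m post m
arrows-at-max {m} pre post p with pre<m , post<m ← split-below pre p =
  trans (arrows-++ pre m post pre<m) (cong (arrows pre ++_) (arrows-bounded m post (All.map ℕ.<⇒≤ post<m)))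

module _ {F : ℕ → ℕ → Set} where

  AvoidingSplit : ℕ → List ℕ → List ℕ → Set
  AvoidingSplit m pre post = pre ++ post ↭ upTo m × ArrowsAvoid F pre × All (λ (u , v) → ¬ F u v) (chain m post m)

  avoidingArrangement⇒split : ∀ {m ys} → AvoidingArrangement F (suc m) ys → AroundMax (AvoidingSplit m) m ys
  avoidingArrangement⇒split (p , avoids) with pre , post , refl , p′ ← split-at-max p =
    pre , post , refl , p′ , All.++⁻ (arrows pre) (subst (All _) (arrows-at-max pre post p′) avoids)

  split⇒avoidingArrangement : ∀ {m ys} → AroundMax (AvoidingSplit m) m ys → AvoidingArrangement F (suc m) ys
  split⇒avoidingArrangement (pre , post , refl , p , avoids-pre , avoids-chain) =
    join-at-max pre post p , subst (All _) (sym (arrows-at-max pre post p)) (All.++⁺ avoids-pre avoids-chain)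

  sorted-avoids : ∀ xs → AllPairs _<_ xs → (∀ x → ¬ F x x) → ArrowsAvoid F xs
  sorted-avoids xs sorted irreflexive =
    subst (All _) (sym (arrows-sorted xs (Linked.AllPairs⇒Linked sorted)))
      (All.map⁺ (All.tabulate (λ {x} _ → irreflexive x)))

arrows-All : ∀ {P : ℕ → Set} xs → All P xs → All (λ (u , v) → P u × P v) (arrows xs)
arrows-All {P} xs all-P = All.zip
  ( All.map⁻ (subst (All P) (sym (arrows-sources xs)) all-P)
  , All.map⁻ (↭.All-resp-↭ (↭-sym (arrows-targets xs)) all-P))

strictly-bounded : ∀ bs → Unique (flatten bs) → All Bounded bs → All (λ (h , r) → All (_< h) r) bs
strictly-bounded [] _ [] = []
strictly-bounded ((h , r) ∷ bs) (h∉ ∷ unique) (bounded ∷ bs-bounded) =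
  All.zipWith (λ (x≤h , h≢x) → ℕ.≤∧≢⇒< x≤h (h≢x ∘ sym)) (bounded , All.++⁻ˡ r h∉)
  ∷ strictly-bounded bs (proj₂ (unique-++⁻ r unique)) bs-bounded

module _ {P : ℕ × ℕ → Set} where

  trivial-blocks⇒sorted : ∀ xs → Unique xs → All P (arrows xs) →
                          (∀ {h r} → All (_< h) r → All P (chain h r h) → r ≡ []) → AllPairs _<_ xs
  trivial-blocks⇒sorted xs unique all-P trivial =
    Linked.Linked⇒AllPairs ℕ.<-trans
      (subst (Linked _<_) (trans (sym (flatten-trivial bs rests-empty)) (flatten-blocks xs)) (proj₂ std))
    where
    bs = blocks xs
    std = blocks-standard xs
    strict = strictly-bounded bs (subst Unique (sym (flatten-blocks xs)) unique) (proj₁ std)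
    per-block : ∀ bs → All P (concatMap cycleArrows bs) → All (λ b → All P (cycleArrows b)) bs
    per-block [] _ = []
    per-block ((h , r) ∷ bs) all-P = All.++⁻ˡ (chain h r h) all-P ∷ per-block bs (All.++⁻ʳ (chain h r h) all-P)
    rests-empty : All (λ b → proj₂ b ≡ []) bs
    rests-empty = All.zipWith (λ (r<h , chain-P) → trivial r<h chain-P) (strict , per-block bs all-P)
    flatten-trivial : ∀ bs → All (λ b → proj₂ b ≡ []) bs → flatten bs ≡ map proj₁ bs
    flatten-trivial [] [] = refl
    flatten-trivial ((h , .[]) ∷ bs) (refl ∷ empty) = cong (h ∷_) (flatten-trivial bs empty)

noFall⇒sorted : ∀ xs → Unique xs → All (λ (u , v) → ¬ v < u) (arrows xs) → AllPairs _<_ xs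
noFall⇒sorted xs unique noFall = trivial-blocks⇒sorted xs unique noFall firstFall
  where
  firstFall : ∀ {h r} → All (_< h) r → All (λ (u , v) → ¬ v < u) (chain h r h) → r ≡ []
  firstFall {r = []} _ _ = refl
  firstFall {r = y ∷ r} (y<h ∷ _) (¬y<h ∷ _) = ⊥-elim (¬y<h y<h)

noRise⇒sorted : ∀ xs → Unique xs → All (λ (u , v) → ¬ u < v) (arrows xs) → AllPairs _<_ xs
noRise⇒sorted xs unique noRise = trivial-blocks⇒sorted xs unique noRise lastRise
  where
  lastRise : ∀ {h r} → All (_< h) r → All (λ (u , v) → ¬ u < v) (chain h r h) → r ≡ []
  lastRise {h} {r} r<h noRise with initLast r
  ... | [] = refl
  ... | r′ ∷ʳ′ ℓ = ⊥-elim (All.lookup (All.++⁻ʳ (chain h r′ ℓ) (subst (All _) (chain-∷ʳ h r′ ℓ h) noRise))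
                                     (here refl) (All.lookup r<h (∈-++⁺ʳ r′ (here refl))))

module _ {R : List ℕ → List ℕ → Set} {m : ℕ} {zs : List ℕ} (zs<m : All (_< m) zs) (unique : Unique zs)
         (g : List ℕ → List ℕ) (g-injective : ∀ {B B′} → g B ≡ g B′ → B ≡ B′) where

  enumerate-by-splits : (∀ {A B} → Interleaving A B zs → R A (g B)) →
                        (∀ {pre post} → R pre post → ∃[ B ] Interleaving pre B zs × post ≡ g B) →
                        Enumerates (AroundMax R m) (map (λ (A , B) → A ++ m ∷ g B) (splits zs))
  enumerate-by-splits sound complete = enumerates-map _ (splits-enumerates zs unique) injective
    (λ {(A , B)} sp → A , g B , refl , sound sp)
    (λ { (pre , post , refl , r) → let B , sp , post≡ = complete r in
                                    (pre , B) , sp , cong (λ post → pre ++ m ∷ post) post≡ })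
    where
    ≢m : ∀ {A B} → Interleaving A B zs → All (_≢ m) A
    ≢m sp = All.map ℕ.<⇒≢ (proj₁ (interleaving-All sp zs<m))
    injective : ∀ {AB AB′} → Interleaving (proj₁ AB) (proj₂ AB) zs → Interleaving (proj₁ AB′) (proj₂ AB′) zs →
                proj₁ AB ++ m ∷ g (proj₂ AB) ≡ proj₁ AB′ ++ m ∷ g (proj₂ AB′) → AB ≡ AB′
    injective {A , _} {A′ , _} sp sp′ eq with refl , gB≡gB′ ← split-injective A A′ (≢m sp) (≢m sp′) eq
      with refl ← g-injective gB≡gB′ = refl

module _ {F : ℕ → ℕ → Set} (irreflexive : ∀ x → ¬ F x x) where

  singleton-enumerates : Enumerates (AvoidingArrangement F 1) ((0 ∷ []) ∷ [])
  singleton-enumerates = record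
    { unique   = [] ∷ []
    ; sound    = λ { (here refl) → ↭-refl , irreflexive 0 ∷ [] }
    ; complete = λ (p , _) → here (↭.↭-singleton-inv p)
    }

  module _ (k : ℕ) where

    TopFixed : List ℕ → Set
    TopFixed ys = ∃[ ys′ ] AvoidingArrangement F (suc k) ys′ × ys ≡ ys′ ∷ʳ suc k

    TopInside : List ℕ → Set
    TopInside = AroundMax (λ pre post → post ≢ [] × AvoidingSplit {F} (suc k) pre post) (suc k)

    enumerate-by-top : ∀ {L M} → Enumerates (AvoidingArrangement F (suc k)) L → Enumerates TopInside M →
                       Enumerates (AvoidingArrangement F (suc (suc k))) (map (_∷ʳ suc k) L ++ M)
    enumerate-by-top {L} enumL enumM = enumerates-⇔ (enumerates-++ fixed enumM disjoint) to from
      where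
      fixed : Enumerates TopFixed (map (_∷ʳ suc k) L)
      fixed = enumerates-map _ enumL (λ _ _ → ∷ʳ-injectiveˡ _ _) (λ {ys′} avoiding → ys′ , avoiding , refl)
                (λ (ys′ , avoiding , eq) → ys′ , avoiding , eq)
      disjoint : ∀ {ys} → TopFixed ys → TopInside ys → ⊥
      disjoint (ys′ , (p′ , _) , refl) (pre , post , eq , post≢[] , p , _) =
        post≢[] (sym (proj₂ (split-injective ys′ pre (All.map ℕ.<⇒≢ (↭upTo⇒< p′))
                                                     (All.map ℕ.<⇒≢ (proj₁ (split-below pre p))) eq)))
      to : ∀ {ys} → TopFixed ys ⊎ TopInside ys → AvoidingArrangement F (suc (suc k)) ys
      to (inj₁ (ys′ , (p′ , avoids) , refl)) =
        split⇒avoidingArrangement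
          (ys′ , [] , refl , subst (_↭ upTo (suc k)) (sym (++-identityʳ ys′)) p′ , avoids , irreflexive (suc k) ∷ [])
      to (inj₂ (pre , post , eq , _ , split)) = split⇒avoidingArrangement (pre , post , eq , split)
      from : ∀ {ys} → AvoidingArrangement F (suc (suc k)) ys → TopFixed ys ⊎ TopInside ys
      from avoiding with avoidingArrangement⇒split avoiding
      ... | pre , [] , refl , p , avoids-pre , _ =
        inj₁ (pre , (subst (_↭ upTo (suc k)) (++-identityʳ pre) p , avoids-pre) , refl)
      ... | pre , y ∷ post , refl , split = inj₂ (pre , y ∷ post , refl , (λ ()) , split)

    module _ {L : List (List ℕ)} (lift extend : List ℕ → List ℕ)
             (lift-split : ∀ pre post → All (_< k) pre → All (_< k) post →
                           lift (pre ++ k ∷ post) ≡ pre ++ suc k ∷ extend post)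
             (extend-injective : ∀ {post post′} → extend post ≡ extend post′ → post ≡ post′)
             (extend≢[] : ∀ post → extend post ≢ [])
             (sound : ∀ {pre post} → AvoidingSplit {F} k pre post → AvoidingSplit {F} (suc k) pre (extend post))
             (complete : ∀ {pre post} → post ≢ [] → AvoidingSplit {F} (suc k) pre post →
                         ∃[ post′ ] post ≡ extend post′ × AvoidingSplit {F} k pre post′) where

      enumerate-by-lift : Enumerates (AvoidingArrangement F (suc k)) L → Enumerates TopInside (map lift L)
      enumerate-by-lift enum = enumerates-map lift enum injective lift-sound lift-complete
        where
        below-top : ∀ pre {post} → pre ++ post ↭ upTo k → All (_≢ suc k) pre
        below-top pre p = All.map (λ x<k → ℕ.<⇒≢ (ℕ.m<n⇒m<1+n x<k)) (proj₁ (split-below pre p))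
        lifted : ∀ {pre post} → AvoidingSplit {F} k pre post →
                 lift (pre ++ k ∷ post) ≡ pre ++ suc k ∷ extend post
        lifted {pre} {post} (p , _) = lift-split pre post (proj₁ (split-below pre p)) (proj₂ (split-below pre p))
        injective : ∀ {ys ys′} → AvoidingArrangement F (suc k) ys → AvoidingArrangement F (suc k) ys′ →
                    lift ys ≡ lift ys′ → ys ≡ ys′
        injective avoiding avoiding′ same
          with pre , post , refl , split@(p , _) ← avoidingArrangement⇒split avoiding
          with pre′ , post′ , refl , split′@(p′ , _) ← avoidingArrangement⇒split avoiding′
          with refl , extend≡ ← split-injective pre pre′ (below-top pre p) (below-top pre′ p′)
                                  (trans (sym (lifted split)) (trans same (lifted split′)))
          with refl ← extend-injective extend≡ = refl
        lift-sound : ∀ {ys} → AvoidingArrangement F (suc k) ys → TopInside (lift ys)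
        lift-sound avoiding with pre , post , refl , split ← avoidingArrangement⇒split avoiding =
          pre , extend post , lifted split , extend≢[] post , sound split
        lift-complete : ∀ {ys} → TopInside ys → ∃[ ys′ ] AvoidingArrangement F (suc k) ys′ × ys ≡ lift ys′
        lift-complete (pre , post , refl , post≢[] , split)
          with post′ , refl , split′ ← complete post≢[] split =
          pre ++ k ∷ post′ , split⇒avoidingArrangement (pre , post′ , refl , split′) , sym (lifted split′)

replace : ℕ → List ℕ → List ℕ → List ℕ
replace k ws [] = []
replace k ws (x ∷ xs) with x ℕ.≟ k
... | yes _ = ws ++ replace k ws xs
... | no _  = x ∷ replace k ws xs

replace-∉ : ∀ {k} ws xs → All (_≢ k) xs → replace k ws xs ≡ xs
replace-∉ ws [] [] = refl
replace-∉ {k} ws (x ∷ xs) (x≢k ∷ xs≢k) with x ℕ.≟ k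
... | yes x≡k = ⊥-elim (x≢k x≡k)
... | no _    = cong (x ∷_) (replace-∉ ws xs xs≢k)

replace-split : ∀ {k} ws pre post → All (_< k) pre → All (_< k) post →
                replace k ws (pre ++ k ∷ post) ≡ pre ++ ws ++ post
replace-split {k} ws [] post _ post<k with k ℕ.≟ k
... | yes _   = cong (ws ++_) (replace-∉ ws post (All.map ℕ.<⇒≢ post<k))
... | no k≢k = ⊥-elim (k≢k refl)
replace-split {k} ws (x ∷ pre) post (x<k ∷ pre<k) post<k with x ℕ.≟ k
... | yes x≡k = ⊥-elim (ℕ.<⇒≢ x<k x≡k)
... | no _    = cong (x ∷_) (replace-split ws pre post pre<k post<k)

-- The six classes of avoiders

≤-with-top : ∀ {m xs} → All (_< m) xs → All (_≤ m) (m ∷ xs)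
≤-with-top xs<m = ℕ.≤-refl ∷ All.map ℕ.<⇒≤ xs<m

module _ (m : ℕ) where
  private
    F = FallBelowTop (suc m)

  fallBelowTop-sound : ∀ {A B} → Interleaving A B (upTo m) → AvoidingSplit {F} m A B
  fallBelowTop-sound {A} {B} sp =
    ↭-sym (toPermutation sp) , sorted-avoids A sorted-A (fallBelowTop-irreflexive (suc m)) , chain⁺ linked into-top
    where
    sorted-A = proj₁ (interleaving-sorted sp (upTo-sorted m))
    sorted-B = proj₂ (interleaving-sorted sp (upTo-sorted m))
    B<m = proj₂ (interleaving-All sp (upTo-below m))
    linked : Linked (λ a b → ¬ F a b) (m ∷ B)
    linked = linked-cons (All.map (λ _ (_ , m<m) → ℕ.<-irrefl refl m<m) B<m)
                         (Linked.map (λ b<b′ (b′<b , _) → ℕ.<-asym b<b′ b′<b) (Linked.AllPairs⇒Linked sorted-B))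
    into-top : All (λ a → ¬ F a m) (m ∷ B)
    into-top = All.map (λ a≤m (m<a , _) → ℕ.<⇒≱ m<a a≤m) (≤-with-top B<m)

  fallBelowTop-complete : ∀ {pre post} → AvoidingSplit {F} m pre post →
                          ∃[ B ] Interleaving pre B (upTo m) × post ≡ B
  fallBelowTop-complete {pre} {post} (p , avoids-pre , avoids-chain) =
    post , ↭-interleaving sorted-pre sorted-post (upTo-sorted m) p , refl
    where
    pre<m = proj₁ (split-below pre p)
    sorted-pre = noFall⇒sorted pre (proj₁ (split-unique pre p))
      (All.zipWith (λ (¬F , (u<m , _)) v<u → ¬F (v<u , s≤s u<m)) (avoids-pre , arrows-All pre pre<m))
    sorted-post = Linked.Linked⇒AllPairs ℕ.<-trans
      (linked-refine (λ a<m _ a≢b ¬F → ℕ.≤∧≢⇒< (ℕ.≮⇒≥ (λ b<a → ¬F (b<a , s≤s a<m))) a≢b)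
        (proj₂ (split-below pre p)) (proj₂ (split-unique pre p)) (Linked.tail (chain⁻ avoids-chain)))

fallBelowTop-avoiders : ℕ → List (List ℕ)
fallBelowTop-avoiders m = map (λ (A , B) → A ++ m ∷ B) (splits (upTo m))

fallBelowTop-enumerates : ∀ m → Enumerates (AvoidingArrangement (FallBelowTop (suc m)) (suc m))
                                           (fallBelowTop-avoiders m)
fallBelowTop-enumerates m = enumerates-⇔
  (enumerate-by-splits (upTo-below m) (Unique.upTo⁺ m) (λ B → B) (λ eq → eq)
     (fallBelowTop-sound m) (fallBelowTop-complete m))
  split⇒avoidingArrangement avoidingArrangement⇒split

fallBelowTop-length : ∀ m → length (fallBelowTop-avoiders m) ≡ 2 ^ m
fallBelowTop-length m = length-map-splits _ (upTo m) (length-upTo m)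

module _ (m : ℕ) where
  private
    F = RiseBelowTop (suc m)

  riseBelowTop-sound : ∀ {A B} → Interleaving A B (upTo m) → AvoidingSplit {F} m A (reverse B)
  riseBelowTop-sound {A} {B} sp =
    ↭-trans (↭.++⁺ˡ A (↭.↭-reverse B)) (↭-sym (toPermutation sp)) ,
    sorted-avoids A sorted-A (riseBelowTop-irreflexive (suc m)) , chain⁺ linked into-top
    where
    sorted-A = proj₁ (interleaving-sorted sp (upTo-sorted m))
    sorted-B = proj₂ (interleaving-sorted sp (upTo-sorted m))
    B<m = ↭.All-resp-↭ (↭-sym (↭.↭-reverse B)) (proj₂ (interleaving-All sp (upTo-below m)))
    linked : Linked (λ a b → ¬ F a b) (m ∷ reverse B)
    linked = linked-cons (All.map (λ b<m (m<b , _) → ℕ.<-asym b<m m<b) B<m)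
                         (Linked.map (λ b′<b (b<b′ , _) → ℕ.<-asym b<b′ b′<b)
                                     (Linked.AllPairs⇒Linked (allPairs-reverse sorted-B)))
    into-top : All (λ a → ¬ F a m) (m ∷ reverse B)
    into-top = All.tabulate (λ _ (_ , m<m) → ℕ.<-irrefl refl m<m)

  riseBelowTop-complete : ∀ {pre post} → AvoidingSplit {F} m pre post →
                          ∃[ B ] Interleaving pre B (upTo m) × post ≡ reverse B
  riseBelowTop-complete {pre} {post} (p , avoids-pre , avoids-chain) =
    reverse post ,
    ↭-interleaving sorted-pre (allPairs-reverse sorted-post) (upTo-sorted m) (↭-trans (↭.++⁺ˡ pre (↭.↭-reverse post)) p) ,
    sym (reverse-involutive post)
    where
    pre<m = proj₁ (split-below pre p)
    sorted-pre = noRise⇒sorted pre (proj₁ (split-unique pre p))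
      (All.zipWith (λ (¬F , (_ , v<m)) u<v → ¬F (u<v , s≤s v<m)) (avoids-pre , arrows-All pre pre<m))
    sorted-post = Linked.Linked⇒AllPairs (flip ℕ.<-trans)
      (linked-refine (λ _ b<m a≢b ¬F → ℕ.≤∧≢⇒< (ℕ.≮⇒≥ (λ a<b → ¬F (a<b , s≤s b<m))) (a≢b ∘ sym))
        (proj₂ (split-below pre p)) (proj₂ (split-unique pre p)) (Linked.tail (chain⁻ avoids-chain)))

riseBelowTop-avoiders : ℕ → List (List ℕ)
riseBelowTop-avoiders m = map (λ (A , B) → A ++ m ∷ reverse B) (splits (upTo m))

riseBelowTop-enumerates : ∀ m → Enumerates (AvoidingArrangement (RiseBelowTop (suc m)) (suc m))
                                           (riseBelowTop-avoiders m)
riseBelowTop-enumerates m = enumerates-⇔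
  (enumerate-by-splits (upTo-below m) (Unique.upTo⁺ m) reverse reverse-injective
     (riseBelowTop-sound m) (riseBelowTop-complete m))
  split⇒avoidingArrangement avoidingArrangement⇒split

riseBelowTop-length : ∀ m → length (riseBelowTop-avoiders m) ≡ 2 ^ m
riseBelowTop-length m = length-map-splits _ (upTo m) (length-upTo m)

module _ (k : ℕ) where
  private
    F = FallAboveBottom (suc (suc k))

  fallAboveBottom-sound : ∀ {A B} → Interleaving A B (positives k) →
                          (0 ∷ B ≢ []) × AvoidingSplit {F} (suc k) A (0 ∷ B)
  fallAboveBottom-sound {A} {B} sp =
    (λ ()) , p , sorted-avoids A sorted-A (fallAboveBottom-irreflexive (suc (suc k))) , chain⁺ linked into-top
    where
    p : A ++ 0 ∷ B ↭ upTo (suc k)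
    p = begin
      A ++ 0 ∷ B          ↭⟨ ↭.shift 0 A B ⟩
      0 ∷ A ++ B          ↭⟨ prep 0 (↭-sym (toPermutation sp)) ⟩
      0 ∷ positives k     ≡⟨ upTo-suc k ⟨
      upTo (suc k)        ∎
      where open PermutationReasoning
    sorted-A = proj₁ (interleaving-sorted sp (positives-sorted k))
    sorted-B = proj₂ (interleaving-sorted sp (positives-sorted k))
    B<top = proj₂ (interleaving-All sp (All.map proj₂ (positives-bounds k)))
    linked : Linked (λ a b → ¬ F a b) (suc k ∷ 0 ∷ B)
    linked = (λ { (() , _) }) ∷ linked-cons (All.tabulate (λ _ → λ { (_ , ()) }))
               (Linked.map (λ b<b′ (_ , b′<b) → ℕ.<-asym b<b′ b′<b) (Linked.AllPairs⇒Linked sorted-B))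
    into-top : All (λ a → ¬ F a (suc k)) (suc k ∷ 0 ∷ B)
    into-top = All.map (λ a≤top (_ , top<a) → ℕ.<⇒≱ top<a a≤top) (ℕ.≤-refl ∷ z≤n ∷ All.map ℕ.<⇒≤ B<top)

  fallAboveBottom-complete : ∀ {pre post} → (post ≢ []) × AvoidingSplit {F} (suc k) pre post →
                             ∃[ B ] Interleaving pre B (positives k) × post ≡ 0 ∷ B
  fallAboveBottom-complete {pre} {[]} (post≢[] , _) = ⊥-elim (post≢[] refl)
  fallAboveBottom-complete {pre} {y ∷ post} (_ , p , avoids-pre , ¬F-top-y ∷ avoids-rest)
    with refl ← ℕ.n≤0⇒n≡0 (ℕ.≮⇒≥ (λ 0<y → ¬F-top-y (0<y , All.lookup (proj₂ (split-below pre p)) (here refl))))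
    = post , ↭-interleaving sorted-pre sorted-post (positives-sorted k) p′ , refl
    where
    p′ : pre ++ post ↭ positives k
    p′ = ↭.drop-mid pre [] (subst (pre ++ 0 ∷ post ↭_) (upTo-suc k) p)
    unique = ↭upTo⇒unique p
    pre≢0 = unique-++-disjoint pre unique (here refl)
    post-nonzero : All (0 ≢_) post
    post-nonzero with 0∉ ∷ _ ← proj₂ (unique-++⁻ pre unique) = 0∉
    post-unique : Unique post
    post-unique with _ ∷ unique-post ← proj₂ (unique-++⁻ pre unique) = unique-post
    sorted-pre = noFall⇒sorted pre (proj₁ (unique-++⁻ pre unique))
      (All.zipWith (λ (¬F , (_ , v≢0)) v<u → ¬F (ℕ.n≢0⇒n>0 v≢0 , v<u)) (avoids-pre , arrows-All pre pre≢0))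
    sorted-post = Linked.Linked⇒AllPairs ℕ.<-trans
      (linked-refine (λ _ 0≢b a≢b ¬F → ℕ.≤∧≢⇒< (ℕ.≮⇒≥ (λ b<a → ¬F (ℕ.n≢0⇒n>0 (0≢b ∘ sym) , b<a))) a≢b)
        post-nonzero post-unique (Linked.tail (chain⁻ avoids-rest)))

fallAboveBottom-avoiders : ℕ → List (List ℕ)
fallAboveBottom-avoiders zero = (0 ∷ []) ∷ []
fallAboveBottom-avoiders (suc k) =
  map (_∷ʳ suc k) (fallAboveBottom-avoiders k) ++ map (λ (A , B) → A ++ suc k ∷ 0 ∷ B) (splits (positives k))

fallAboveBottom-enumerates : ∀ m → Enumerates (AvoidingArrangement (FallAboveBottom (suc m)) (suc m))
                                              (fallAboveBottom-avoiders m)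
fallAboveBottom-enumerates zero = singleton-enumerates (fallAboveBottom-irreflexive 1)
fallAboveBottom-enumerates (suc k) =
  enumerate-by-top (fallAboveBottom-irreflexive (suc (suc k))) k (fallAboveBottom-enumerates k)
    (enumerate-by-splits (All.map proj₂ (positives-bounds k)) (positives-unique k) (0 ∷_) (λ { refl → refl })
       (fallAboveBottom-sound k) (fallAboveBottom-complete k))

fallAboveBottom-length : ∀ m → length (fallAboveBottom-avoiders m) ≡ 2 ^ m
fallAboveBottom-length zero = refl
fallAboveBottom-length (suc k) = length-map-++ (_∷ʳ suc k) (fallAboveBottom-avoiders k) {k = k}
  (fallAboveBottom-length k) (length-map-splits _ (positives k) (positives-length k))

module _ (k : ℕ) where
  private
    F = RiseAboveBottom (suc (suc k))

  riseAboveBottom-sound : ∀ {A B} → Interleaving A B (positives k) →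
                          (reverse B ∷ʳ 0 ≢ []) × AvoidingSplit {F} (suc k) A (reverse B ∷ʳ 0)
  riseAboveBottom-sound {A} {B} sp =
    ∷ʳ≢[] (reverse B) , p , sorted-avoids A sorted-A (riseAboveBottom-irreflexive (suc (suc k))) ,
    subst (All _) (sym (chain-∷ʳ (suc k) (reverse B) 0 (suc k)))
      (All.++⁺ (chain⁺ linked (All.tabulate (λ _ → λ { (_ , ()) }))) ((λ { (() , _) }) ∷ []))
    where
    p : A ++ (reverse B ∷ʳ 0) ↭ upTo (suc k)
    p = begin
      A ++ (reverse B ∷ʳ 0)   ≡⟨ ++-assoc A (reverse B) (0 ∷ []) ⟨
      (A ++ reverse B) ∷ʳ 0   ↭⟨ ↭-sym (↭.∷↭∷ʳ 0 (A ++ reverse B)) ⟩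
      0 ∷ A ++ reverse B      ↭⟨ prep 0 (↭.++⁺ˡ A (↭.↭-reverse B)) ⟩
      0 ∷ A ++ B              ↭⟨ prep 0 (↭-sym (toPermutation sp)) ⟩
      0 ∷ positives k         ≡⟨ upTo-suc k ⟨
      upTo (suc k)            ∎
      where open PermutationReasoning
    sorted-A = proj₁ (interleaving-sorted sp (positives-sorted k))
    sorted-B = proj₂ (interleaving-sorted sp (positives-sorted k))
    B<top = ↭.All-resp-↭ (↭-sym (↭.↭-reverse B)) (proj₂ (interleaving-All sp (All.map proj₂ (positives-bounds k))))
    linked : Linked (λ a b → ¬ F a b) (suc k ∷ reverse B)
    linked = linked-cons (All.map (λ b<top (_ , top<b) → ℕ.<-asym b<top top<b) B<top)
               (Linked.map (λ b<a (_ , a<b) → ℕ.<-asym a<b b<a) (Linked.AllPairs⇒Linked (allPairs-reverse sorted-B)))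

  riseAboveBottom-complete : ∀ {pre post} → (post ≢ []) × AvoidingSplit {F} (suc k) pre post →
                             ∃[ B ] Interleaving pre B (positives k) × post ≡ reverse B ∷ʳ 0
  riseAboveBottom-complete {pre} {post} (post≢[] , p , avoids-pre , avoids-chain) with initLast post
  ... | [] = ⊥-elim (post≢[] refl)
  ... | post′ ∷ʳ′ y
    with avoids-chain′ , ¬F-y-top ∷ [] ←
           All.++⁻ (chain (suc k) post′ y) (subst (All _) (chain-∷ʳ (suc k) post′ y (suc k)) avoids-chain)
    with refl ← ℕ.n≤0⇒n≡0 (ℕ.≮⇒≥ (λ 0<y →
                  ¬F-y-top (0<y , All.lookup (proj₂ (split-below pre p)) (∈-++⁺ʳ post′ (here refl)))))
    = reverse post′ , ↭-interleaving sorted-pre (allPairs-reverse sorted-post′) (positives-sorted k) p′ ,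
      cong (_∷ʳ 0) (sym (reverse-involutive post′))
    where
    p′ : pre ++ reverse post′ ↭ positives k
    p′ = begin
      pre ++ reverse post′    ↭⟨ ↭.++⁺ˡ pre (↭.↭-reverse post′) ⟩
      pre ++ post′            ≡⟨ ++-identityʳ (pre ++ post′) ⟨
      (pre ++ post′) ++ []    ↭⟨ ↭.drop-mid (pre ++ post′) []
                                   (subst₂ _↭_ (sym (++-assoc pre post′ (0 ∷ []))) (upTo-suc k) p) ⟩
      positives k             ∎
      where open PermutationReasoning
    unique = ↭upTo⇒unique p
    pre≢0 = unique-++-disjoint pre unique (∈-++⁺ʳ post′ (here refl))
    unique-post = proj₂ (unique-++⁻ pre unique)
    post′≢0 = unique-++-disjoint post′ unique-post (here refl)
    sorted-pre = noRise⇒sorted pre (proj₁ (unique-++⁻ pre unique))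
      (All.zipWith (λ (¬F , (u≢0 , _)) u<v → ¬F (ℕ.n≢0⇒n>0 u≢0 , u<v)) (avoids-pre , arrows-All pre pre≢0))
    sorted-post′ = Linked.Linked⇒AllPairs (flip ℕ.<-trans)
      (linked-refine (λ a≢0 _ a≢b ¬F → ℕ.≤∧≢⇒< (ℕ.≮⇒≥ (λ a<b → ¬F (ℕ.n≢0⇒n>0 a≢0 , a<b))) (a≢b ∘ sym))
        post′≢0 (proj₁ (unique-++⁻ post′ unique-post)) (Linked.tail (chain⁻ avoids-chain′)))

riseAboveBottom-avoiders : ℕ → List (List ℕ)
riseAboveBottom-avoiders zero = (0 ∷ []) ∷ []
riseAboveBottom-avoiders (suc k) =
  map (_∷ʳ suc k) (riseAboveBottom-avoiders k) ++
  map (λ (A , B) → A ++ suc k ∷ (reverse B ∷ʳ 0)) (splits (positives k))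

riseAboveBottom-enumerates : ∀ m → Enumerates (AvoidingArrangement (RiseAboveBottom (suc m)) (suc m))
                                              (riseAboveBottom-avoiders m)
riseAboveBottom-enumerates zero = singleton-enumerates (riseAboveBottom-irreflexive 1)
riseAboveBottom-enumerates (suc k) =
  enumerate-by-top (riseAboveBottom-irreflexive (suc (suc k))) k (riseAboveBottom-enumerates k)
    (enumerate-by-splits (All.map proj₂ (positives-bounds k)) (positives-unique k) (λ B → reverse B ∷ʳ 0)
       (λ eq → reverse-injective (∷ʳ-injectiveˡ _ _ eq)) (riseAboveBottom-sound k) (riseAboveBottom-complete k))

riseAboveBottom-length : ∀ m → length (riseAboveBottom-avoiders m) ≡ 2 ^ m
riseAboveBottom-length zero = refl
riseAboveBottom-length (suc k) = length-map-++ (_∷ʳ suc k) (riseAboveBottom-avoiders k) {k = k}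
  (riseAboveBottom-length k) (length-map-splits _ (positives k) (positives-length k))

module _ (k : ℕ) where
  private
    F = LongRise (suc (suc k))

  longRise-lift-split : ∀ pre post → All (_< k) pre → All (_< k) post →
                        replace k (suc k ∷ []) (pre ++ k ∷ post) ∷ʳ k ≡ pre ++ suc k ∷ (post ∷ʳ k)
  longRise-lift-split pre post pre<k post<k =
    trans (cong (_∷ʳ k) (replace-split (suc k ∷ []) pre post pre<k post<k)) (++-assoc pre (suc k ∷ post) (k ∷ []))

  longRise-sound : ∀ {pre post} → AvoidingSplit {F} k pre post → AvoidingSplit {F} (suc k) pre (post ∷ʳ k)
  longRise-sound {pre} {post} (p , avoids-pre , avoids-chain) =
    p′ , avoids-pre ,
    subst (All _) (sym (chain-∷ʳ (suc k) post k (suc k)))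
      (All.++⁺ (chain-swapˡ avoids-chain from-top) ((λ k+1<k+1 → ℕ.<-irrefl refl k+1<k+1) ∷ []))
    where
    p′ : pre ++ (post ∷ʳ k) ↭ upTo (suc k)
    p′ = begin
      pre ++ (post ∷ʳ k)   ≡⟨ ++-assoc pre post (k ∷ []) ⟨
      (pre ++ post) ∷ʳ k   ↭⟨ ↭.++⁺ʳ (k ∷ []) p ⟩
      upTo k ∷ʳ k          ≡⟨ upTo-∷ʳ k ⟩
      upTo (suc k)         ∎
      where open PermutationReasoning
    from-top : All (λ b → ¬ F (suc k) b) (k ∷ post)
    from-top = All.map (λ b≤k k+2<b → ℕ.<⇒≱ k+2<b (ℕ.m≤n⇒m≤1+n (ℕ.m≤n⇒m≤1+n b≤k)))
                       (≤-with-top (proj₂ (split-below pre p)))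

  longRise-complete : ∀ {pre post} → post ≢ [] → AvoidingSplit {F} (suc k) pre post →
                      ∃[ post′ ] post ≡ post′ ∷ʳ k × AvoidingSplit {F} k pre post′
  longRise-complete {pre} {post} post≢[] (p , avoids-pre , avoids-chain) with initLast post
  ... | [] = ⊥-elim (post≢[] refl)
  ... | post′ ∷ʳ′ y
    with avoids-chain′ , ¬F-y-top ∷ [] ←
           All.++⁻ (chain (suc k) post′ y) (subst (All _) (chain-∷ʳ (suc k) post′ y (suc k)) avoids-chain)
    with post′<k+1 , y<k+1 ∷ [] ← All.++⁻ post′ (proj₂ (split-below pre p))
    with refl ← ℕ.≤-antisym (ℕ.≤-pred y<k+1) (ℕ.≤-pred (ℕ.≮⇒≥ ¬F-y-top))
    = post′ , refl , p′ , avoids-pre , chain-swapˡ avoids-chain′ from-k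
    where
    p′ : pre ++ post′ ↭ upTo k
    p′ = ↭-∷ʳ-cancel (subst₂ _↭_ (sym (++-assoc pre post′ (k ∷ []))) (sym (upTo-∷ʳ k)) p)
    from-k : All (λ b → ¬ F k b) (k ∷ post′)
    from-k = All.map (λ b≤k k+1<b → ℕ.<⇒≱ k+1<b (ℕ.m≤n⇒m≤1+n b≤k)) (ℕ.≤-refl ∷ All.map ℕ.≤-pred post′<k+1)

-- The new maximum suc k is appended as a fixed point, or it takes the place of k in π,
-- which moves to the end of the last cycle.
longRise-avoiders : ℕ → List (List ℕ)
longRise-avoiders zero = (0 ∷ []) ∷ []
longRise-avoiders (suc k) =
  map (_∷ʳ suc k) (longRise-avoiders k) ++ map (λ ys → replace k (suc k ∷ []) ys ∷ʳ k) (longRise-avoiders k)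

longRise-enumerates : ∀ m → Enumerates (AvoidingArrangement (LongRise (suc m)) (suc m)) (longRise-avoiders m)
longRise-enumerates zero = singleton-enumerates (longRise-irreflexive 1)
longRise-enumerates (suc k) =
  enumerate-by-top (longRise-irreflexive (suc (suc k))) k (longRise-enumerates k)
    (enumerate-by-lift (longRise-irreflexive (suc (suc k))) k _ (_∷ʳ k) (longRise-lift-split k) (∷ʳ-injectiveˡ _ _)
       (λ post → ∷ʳ≢[] post) (longRise-sound k) (longRise-complete k) (longRise-enumerates k))

longRise-length : ∀ m → length (longRise-avoiders m) ≡ 2 ^ m
longRise-length zero = refl
longRise-length (suc k) = length-map-++ (_∷ʳ suc k) (longRise-avoiders k) {k = k}
  (longRise-length k) (trans (length-map _ (longRise-avoiders k)) (longRise-length k))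

module _ (k : ℕ) where
  private
    F = LongFall (suc (suc k))

  longFall-sound : ∀ {pre post} → AvoidingSplit {F} k pre post → AvoidingSplit {F} (suc k) pre (k ∷ post)
  longFall-sound {pre} {post} (p , avoids-pre , avoids-chain) =
    join-at-max pre post p , avoids-pre , (λ k+1<k+1 → ℕ.<-irrefl refl k+1<k+1) ∷ chain-swapʳ avoids-chain into-top
    where
    into-top : All (λ a → ¬ F a (suc k)) (k ∷ post)
    into-top = All.map (λ a≤k k+2<a → ℕ.<⇒≱ k+2<a (ℕ.m≤n⇒m≤1+n (ℕ.m≤n⇒m≤1+n a≤k)))
                       (≤-with-top (proj₂ (split-below pre p)))

  longFall-complete : ∀ {pre post} → post ≢ [] → AvoidingSplit {F} (suc k) pre post →
                      ∃[ post′ ] post ≡ k ∷ post′ × AvoidingSplit {F} k pre post′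
  longFall-complete {pre} {[]} post≢[] _ = ⊥-elim (post≢[] refl)
  longFall-complete {pre} {y ∷ post′} _ (p , avoids-pre , ¬F-top-y ∷ avoids-chain)
    with y<k+1 ∷ post′<k+1 ← proj₂ (split-below pre p)
    with refl ← ℕ.≤-antisym (ℕ.≤-pred y<k+1) (ℕ.≤-pred (ℕ.≮⇒≥ ¬F-top-y))
    = post′ , refl , join-at-max⁻ pre post′ p , avoids-pre , chain-swapʳ avoids-chain into-k
    where
    into-k : All (λ a → ¬ F a k) (k ∷ post′)
    into-k = All.map (λ a≤k k+1<a → ℕ.<⇒≱ k+1<a (ℕ.m≤n⇒m≤1+n a≤k)) (ℕ.≤-refl ∷ All.map ℕ.≤-pred post′<k+1)

-- The new maximum suc k is appended as a fixed point, or it is inserted just before k.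
longFall-avoiders : ℕ → List (List ℕ)
longFall-avoiders zero = (0 ∷ []) ∷ []
longFall-avoiders (suc k) =
  map (_∷ʳ suc k) (longFall-avoiders k) ++ map (replace k (suc k ∷ k ∷ [])) (longFall-avoiders k)

longFall-enumerates : ∀ m → Enumerates (AvoidingArrangement (LongFall (suc m)) (suc m)) (longFall-avoiders m)
longFall-enumerates zero = singleton-enumerates (longFall-irreflexive 1)
longFall-enumerates (suc k) =
  enumerate-by-top (longFall-irreflexive (suc (suc k))) k (longFall-enumerates k)
    (enumerate-by-lift (longFall-irreflexive (suc (suc k))) k _ (k ∷_) (replace-split _) (λ { refl → refl }) (λ _ ())
       (longFall-sound k) (longFall-complete k) (longFall-enumerates k))

longFall-length : ∀ m → length (longFall-avoiders m) ≡ 2 ^ m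
longFall-length zero = refl
longFall-length (suc k) = length-map-++ (_∷ʳ suc k) (longFall-avoiders k) {k = k}
  (longFall-length k) (trans (length-map _ (longFall-avoiders k)) (longFall-length k))

-- From lists of naturals to permutations

toℕs : ∀ {n k} → Vec (Fin n) k → List ℕ
toℕs v = map toℕ (toList v)

-- Out-of-range entries are reduced mod suc m and missing ones become 0; neither happens for an
-- arrangement of [0, suc m).
fromℕs : ∀ {m} k → List ℕ → Vec (Fin (suc m)) k
fromℕs zero _ = Vec.[]
fromℕs (suc k) [] = 0F Vec.∷ fromℕs k []
fromℕs {m} (suc k) (y ∷ ys) = (y mod suc m) Vec.∷ fromℕs k ys

toℕs-fromℕs : ∀ {m} k ys → length ys ≡ k → All (_< suc m) ys → toℕs (fromℕs {m} k ys) ≡ ys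
toℕs-fromℕs zero [] _ [] = refl
toℕs-fromℕs (suc k) (y ∷ ys) length≡ (y< ∷ ys<) =
  cong₂ _∷_ (trans (toℕ-fromℕ< _) (m<n⇒m%n≡m y<)) (toℕs-fromℕs k ys (ℕ.suc-injective length≡) ys<)

fromℕs-toℕs : ∀ {m k} (v : Vec (Fin (suc m)) k) → fromℕs k (toℕs v) ≡ v
fromℕs-toℕs Vec.[] = refl
fromℕs-toℕs (x Vec.∷ v) =
  cong₂ Vec._∷_ (toℕ-injective (trans (toℕ-fromℕ< _) (m<n⇒m%n≡m (toℕ<n x)))) (fromℕs-toℕs v)

isPerm⇒↭ : ∀ {n} (π : Perm n) → IsPerm π → toℕs π ↭ upTo n
isPerm⇒↭ {n} π perm =
  ∼bag⇒↭ (unique∧set⇒bag (Unique.map⁺ toℕ-injective (injective⇒unique π perm)) (Unique.upTo⁺ n) (mk⇔ to from))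
  where
  to : ∀ {i} → i ∈ toℕs π → i ∈ upTo n
  to i∈ with x , _ , refl ← ∈-map⁻ toℕ i∈ = ∈-upTo⁺ (toℕ<n x)
  from : ∀ {i} → i ∈ upTo n → i ∈ toℕs π
  from i∈ = subst (_∈ toℕs π) (toℕ-fromℕ< (∈-upTo⁻ i∈)) (∈-map⁺ toℕ (isPerm⇒∈ π perm _))

module _ (a b c : Fin 3) (F : ℕ → ℕ → ℕ → Set)
         (realizes⇒ : ∀ {n} {u v : Fin n} → Realizes b c u v → F n (toℕ u) (toℕ v))
         (realizes⇐ : ∀ {m} {u v : Fin (suc m)} → F (suc m) (toℕ u) (toℕ v) → Realizes b c u v) where

  private
    α = mkPat (a Vec.∷ Vec.[]) ((b , c) ∷ [])

  avoids⇒arrowsAvoid : ∀ {m} {π : Perm (suc m)} → IsPerm π → Avoids α π → ArrowsAvoid (F (suc m)) (toℕs π)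
  avoids⇒arrowsAvoid {π = π} perm avoids = subst (All _) (sym (arrows-map toℕ (toList π)))
    (All.map⁺ (All.tabulate λ uv∈ f-uv → avoids (arrow⇒contains a b c perm uv∈ (realizes⇐ f-uv))))

  arrowsAvoid⇒avoids : ∀ {n} {π : Perm n} → ArrowsAvoid (F n) (toℕs π) → Avoids α π
  arrowsAvoid⇒avoids {π = π} arrowsAvoid contains with uv , uv∈ , realizes ← contains⇒arrow a b c contains =
    All.lookup (All.map⁻ (subst (All _) (arrows-map toℕ (toList π)) arrowsAvoid)) uv∈ (realizes⇒ realizes)

  avoidCount : ∀ {m L} → Enumerates (AvoidingArrangement (F (suc m)) (suc m)) L → length L ≡ 2 ^ m →
               AvoidCountIs α (suc m) (2 ^ m)
  avoidCount {m} {L} enum |L| =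
    map (fromℕs (suc m)) L , unique , All.tabulate sound , (λ π perm avoids → complete (perm , avoids)) ,
    trans (length-map _ L) |L|
    where
    toℕs-fromℕs′ : ∀ {ys} → ys ↭ upTo (suc m) → toℕs (fromℕs {m} (suc m) ys) ≡ ys
    toℕs-fromℕs′ {ys} p = toℕs-fromℕs (suc m) ys (trans (↭.↭-length p) (length-upTo (suc m))) (↭upTo⇒< p)
    injective : ∀ {ys ys′} → AvoidingArrangement (F (suc m)) (suc m) ys →
                AvoidingArrangement (F (suc m)) (suc m) ys′ →
                fromℕs (suc m) ys ≡ fromℕs (suc m) ys′ → ys ≡ ys′
    injective (p , _) (p′ , _) same = trans (sym (toℕs-fromℕs′ p)) (trans (cong toℕs same) (toℕs-fromℕs′ p′))
    avoiding-perm : ∀ {ys} → AvoidingArrangement (F (suc m)) (suc m) ys →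
                    IsPerm (fromℕs (suc m) ys) × Avoids α (fromℕs (suc m) ys)
    avoiding-perm (p , arrowsAvoid) =
      unique⇒injective _ (Unique.map⁻ (subst Unique (sym (toℕs-fromℕs′ p)) (↭upTo⇒unique p))) ,
      arrowsAvoid⇒avoids (subst (ArrowsAvoid (F (suc m))) (sym (toℕs-fromℕs′ p)) arrowsAvoid)
    perm-avoiding : ∀ {π} → IsPerm π × Avoids α π →
                    ∃[ ys ] AvoidingArrangement (F (suc m)) (suc m) ys × π ≡ fromℕs (suc m) ys
    perm-avoiding {π} (perm , avoids) =
      toℕs π , (isPerm⇒↭ π perm , avoids⇒arrowsAvoid perm avoids) , sym (fromℕs-toℕs π)
    perms : Enumerates (λ π → IsPerm π × Avoids α π) (map (fromℕs (suc m)) L)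
    perms = enumerates-map (fromℕs (suc m)) enum injective avoiding-perm perm-avoiding
    open Enumerates perms

module _ where
  open import Data.Vec using (_∷_; [])

  theorem2p4 : (a b c : Fin 3) → a ≢ b → a ≢ c → b ≢ c →
    (n : ℕ) → 1 ≤ n →
    AvoidCountIs (mkPat (a ∷ []) ((b , c) List.∷ List.[])) n (2 ^ (n ∸ 1))
  theorem2p4 a 0F 0F _ _ b≢c _ _ = ⊥-elim (b≢c refl)
  theorem2p4 a 1F 1F _ _ b≢c _ _ = ⊥-elim (b≢c refl)
  theorem2p4 a 2F 2F _ _ b≢c _ _ = ⊥-elim (b≢c refl)
  theorem2p4 a 0F 1F _ _ _ (suc m) _ = avoidCount a 0F 1F RiseBelowTop realizes⇒riseBelowTop realizes⇐riseBelowTop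
                                         (riseBelowTop-enumerates m) (riseBelowTop-length m)
  theorem2p4 a 1F 0F _ _ _ (suc m) _ = avoidCount a 1F 0F FallBelowTop realizes⇒fallBelowTop realizes⇐fallBelowTop
                                         (fallBelowTop-enumerates m) (fallBelowTop-length m)
  theorem2p4 a 1F 2F _ _ _ (suc m) _ = avoidCount a 1F 2F RiseAboveBottom realizes⇒riseAboveBottom realizes⇐riseAboveBottom
                                         (riseAboveBottom-enumerates m) (riseAboveBottom-length m)
  theorem2p4 a 2F 1F _ _ _ (suc m) _ = avoidCount a 2F 1F FallAboveBottom realizes⇒fallAboveBottom realizes⇐fallAboveBottom
                                         (fallAboveBottom-enumerates m) (fallAboveBottom-length m)
  theorem2p4 a 0F 2F _ _ _ (suc m) _ = avoidCount a 0F 2F LongRise realizes⇒longRise realizes⇐longRise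
                                         (longRise-enumerates m) (longRise-length m)
  theorem2p4 a 2F 0F _ _ _ (suc m) _ = avoidCount a 2F 0F LongFall realizes⇒longFall realizes⇐longFall
                                         (longFall-enumerates m) (longFall-length m)
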